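{- Let $S$ be a star graph with center $c$ and let $I$ be a subset of the leaves of $S$. The star inequalities, the bidirected-edge inequalities and the forked-tree inequality (defined below) form a minimal H-representation of $\mathrm{CIM}_S^I$. Moreover, $\mathrm{CIM}_S^I$ is a simplex.
   Context: A star graph with center $c$ is a tree on at least $3$ nodes in which every node other than $c$ is a leaf. Characteristic imsets: for a DAG $\mathcal{D}$ on a finite node set $V$ and $A\subseteq V$, $c_{\mathcal{D}}(A)=1$ if some $a\in A$ has every $b\in A\setminus\{a\}$ as a parent in $\mathcal{D}$, and $0$ otherwise. For a DAG $\mathcal{G}$ with skeleton $S$, $\mathcal{G}^I$ is obtained by adding a new node $u'$ and edge $u'\to u$ for each $u\in I$; $S^I$ is $S$ with these edges added. $\mathrm{CIM}_S^I=\mathrm{conv}\{c_{\mathcal{G}^I}:\mathcal{G}\text{ a DAG with skeleton }S\}$, regarded in the coordinates $x_A$ for $A$ with $c\in A\subseteq V(S)$, $|A|\ge3$, and $A=\{c,u,u'\}$, $u\in I$ (all other coordinates being constant on the polytope). Star inequalities: for each $V'$ with $c\in V'\subseteq V(S)$, $|V'|\ge3$: $\sum_{V'\subseteq A\subseteq V(S)}(-1)^{|A\setminus V'|}x_A\ge0$. Bidirected-edge inequalities: for each $u\in I$: $x_{cuu'}+\sum_{\emptyset\ne A\subseteq V(S)\setminus\{u,c\}}(-1)^{|A|+1}x_{A\cup\{u,c\}}\le1$. Forked-tree inequality: with $\mathbb{1}_{c\to L}(x)=\sum_{c\in A\subseteq V(S)\setminus L,\ |A|\ge3}\sum_{B\subseteq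 L}(-1)^{|A\cup B|-1}(|A|-2)x_{A\cup B}$ for $L$ a set of leaves, and $\#^{I}(x)=\sum_{c\in A\subseteq \{c\}\cup I,\ |A|\ge3}(-1)^{|A|-1}x_A$, the inequality is $\mathbb{1}_{c\to I}(x)+\sum_{u\in I}(1-x_{cuu'})\le1+\#^{I}(x)$. -}

module Defs where

open import Data.Bool using (Bool; true; false; if_then_else_; _∧_; _∨_; not)
open import Data.Nat as ℕ using (ℕ; zero; suc; _∸_)
open import Data.Fin using (Fin; zero; suc)
import Data.Fin.Properties as FinP
open import Data.Fin.Subset using (Subset; ∣_∣; _∈_; _⊆_; ⁅_⁆; _∪_; ⊤; ⊥; ∁) renaming (_-_ to _minus_)
open import Data.Fin.Subset.Properties using (_∈?_; _⊆?_)
open import Data.Vec using (Vec; []; _∷_)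
open import Data.List using (List; []; _∷_; map; filter; filterᵇ; foldr; _++_; allFin)
open import Data.Bool.ListAction using (any; all)
open import Data.Integer using (+_)
open import Data.Rational as Q using (ℚ; 0ℚ; 1ℚ; _+_; _*_; -_; _/_)
open import Data.Product using (Σ; ∃; _×_; _,_; Σ-syntax; ∃-syntax)
open import Data.Sum using (_⊎_; inj₁; inj₂)
open import Relation.Nullary using (¬_; does; yes; no)
open import Relation.Binary.PropositionalEquality using (_≡_; _≢_)
open import Function.Bundles using (_⇔_)

-- The star graph S: center c and leaves 1..n (Fin n), n ≥ 2.
-- The DAG 𝒢^I: nodes of S plus a new node u' for each u ∈ I.

data Node (n : ℕ) : Set where
  center : Node n
  leaf   : Fin n → Node n
  prime  : Fin n → Node n       -- u'  (only relevant for u ∈ I)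

eqNode : ∀ {n} → Node n → Node n → Bool
eqNode center    center    = true
eqNode (leaf u)  (leaf v)  = does (u FinP.≟ v)
eqNode (prime u) (prime v) = does (u FinP.≟ v)
eqNode _         _         = false

-- A DAG with skeleton S (a star, hence a tree: every orientation of its
-- edges is acyclic) is an orientation of the edges c — u:
-- o u = true means c → u, o u = false means u → c.
Orientation : ℕ → Set
Orientation n = Fin n → Bool

inSub : ∀ {n} → Fin n → Subset n → Bool
inSub u I = does (u ∈? I)

arrow : ∀ {n} → Orientation n → Subset n → Node n → Node n → Bool
arrow o I center    (leaf u) = o u
arrow o I (leaf u)  center   = not (o u)
arrow o I (prime u) (leaf v) = does (u FinP.≟ v) ∧ inSub u I
arrow o I _         _        = false

-- Characteristic imset: c_D(A) = 1 iff some a ∈ A has every other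
-- b ∈ A as a parent.  A is given as a list of (distinct) nodes.
charImset : ∀ {n} → Orientation n → Subset n → List (Node n) → Bool
charImset o I A = any (λ a → all (λ b → eqNode b a ∨ arrow o I b a) A) A

-- Coordinates: x_A for c ∈ A ⊆ V(S), |A| ≥ 3 (i.e. A = {c} ∪ T with T a
-- set of leaves, |T| ≥ 2), and x_{c u u'} for u ∈ I.

Coord : (n : ℕ) → Subset n → Set
Coord n I = (Σ[ T ∈ Subset n ] 2 ℕ.≤ ∣ T ∣) ⊎ (Σ[ u ∈ Fin n ] u ∈ I)

Point : (n : ℕ) → Subset n → Set
Point n I = Coord n I → ℚ

leavesOf : ∀ {n} → Subset n → List (Node n)
leavesOf {n} T = map leaf (filter (λ u → u ∈? T) (allFin n))

coordNodes : ∀ {n I} → Coord n I → List (Node n)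
coordNodes (inj₁ (T , _)) = center ∷ leavesOf T
coordNodes (inj₂ (u , _)) = center ∷ leaf u ∷ prime u ∷ []

b2q : Bool → ℚ
b2q true  = 1ℚ
b2q false = 0ℚ

cimVertex : ∀ {n} (I : Subset n) → Orientation n → Point n I
cimVertex I o κ = b2q (charImset o I (coordNodes κ))

sumFin : ∀ {k} → (Fin k → ℚ) → ℚ
sumFin {zero}  f = 0ℚ
sumFin {suc k} f = f zero + sumFin (λ i → f (suc i))

sumList : ∀ {a} {A : Set a} → (A → ℚ) → List A → ℚ
sumList f = foldr (λ a r → f a + r) 0ℚ

InCIM : ∀ {n} (I : Subset n) → Point n I → Set
InCIM {n} I x =
  ∃[ k ] Σ[ w ∈ (Fin k → ℚ) ] Σ[ os ∈ (Fin k → Orientation n) ]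
    ((∀ i → 0ℚ Q.≤ w i) × sumFin w ≡ 1ℚ ×
     (∀ κ → x κ ≡ sumFin (λ i → w i * cimVertex I (os i) κ)))

InConv : ∀ {n} {I : Subset n} {m} → (Fin m → Point n I) → Point n I → Set
InConv {m = m} p x =
  Σ[ w ∈ (Fin m → ℚ) ]
    ((∀ i → 0ℚ Q.≤ w i) × sumFin w ≡ 1ℚ ×
     (∀ κ → x κ ≡ sumFin (λ i → w i * p i κ)))

AffinelyIndependent : ∀ {n} {I : Subset n} {m} → (Fin m → Point n I) → Set
AffinelyIndependent {m = m} p =
  (l : Fin m → ℚ) → sumFin l ≡ 0ℚ →
  (∀ κ → sumFin (λ i → l i * p i κ) ≡ 0ℚ) → ∀ i → l i ≡ 0ℚ

IsSimplex : ∀ {n} (I : Subset n) → (Point n I → Set) → Set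
IsSimplex {n} I P =
  ∃[ m ] Σ[ p ∈ (Fin m → Point n I) ]
    (AffinelyIndependent p × (∀ x → P x ⇔ InConv p x))

allSubsets : (n : ℕ) → List (Subset n)
allSubsets zero    = [] ∷ []
allSubsets (suc n) = map (true ∷_) (allSubsets n) ++ map (false ∷_) (allSubsets n)

sumSub : ∀ {n} → (Subset n → Bool) → (Subset n → ℚ) → ℚ
sumSub {n} P f = sumList f (filterᵇ P (allSubsets n))

sgn : ℕ → ℚ
sgn zero          = 1ℚ
sgn (suc zero)    = - 1ℚ
sgn (suc (suc k)) = sgn k

nat : ℕ → ℚ
nat k = + k / 1

sub? : ∀ {n} → Subset n → Subset n → Bool
sub? A B = does (A ⊆? B)

-- x_{{c} ∪ U}  (used only for |U| ≥ 2)
xS : ∀ {n} {I : Subset n} → Point n I → Subset n → ℚ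
xS x U with 2 ℕ.≤? ∣ U ∣
... | yes p = x (inj₁ (U , p))
... | no _  = 0ℚ

-- x_{c u u'}  (used only for u ∈ I)
xB : ∀ {n} {I : Subset n} → Point n I → Fin n → ℚ
xB {I = I} x u with u ∈? I
... | yes p = x (inj₂ (u , p))
... | no _  = 0ℚ

data Ineq (n : ℕ) : Set where
  star   : Subset n → Ineq n     -- V' = {c} ∪ T
  bidir  : Fin n → Ineq n
  forked : Ineq n

ValidIneq : ∀ {n} → Subset n → Ineq n → Set
ValidIneq I (star T)  = 2 ℕ.≤ ∣ T ∣
ValidIneq I (bidir u) = u ∈ I
ValidIneq I forked    = Data.Unit.⊤
  where import Data.Unit

starLHS : ∀ {n} {I : Subset n} → Subset n → Point n I → ℚ
starLHS T x = sumSub (sub? T) (λ U → sgn (∣ U ∣ ∸ ∣ T ∣) * xS x U)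

bidirLHS : ∀ {n} {I : Subset n} → Fin n → Point n I → ℚ
bidirLHS u x =
  xB x u + sumSub (λ A → sub? A (∁ ⁅ u ⁆) ∧ not (does (∣ A ∣ ℕ.≟ 0)))
                  (λ A → sgn (suc ∣ A ∣) * xS x (A ∪ ⁅ u ⁆))

-- 𝟙_{c→I}(x) = Σ_{A = {c}∪T, T ⊆ leaves \ I, |T| ≥ 2} Σ_{B ⊆ I}
--                 (-1)^{|A ∪ B| - 1} (|A| - 2) x_{A ∪ B}
-- (|A| = |T| + 1, |A ∪ B| = |T| + |B| + 1)
oneCI : ∀ {n} (I : Subset n) → Point n I → ℚ
oneCI I x =
  sumSub (λ T → sub? T (∁ I) ∧ does (2 ℕ.≤? ∣ T ∣))
    (λ T → sumSub (λ B → sub? B I)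
      (λ B → sgn (∣ T ∣ ℕ.+ ∣ B ∣) * (nat (∣ T ∣ ∸ 1) * xS x (T ∪ B))))

-- #^I(x) = Σ_{A = {c}∪T, T ⊆ I, |T| ≥ 2} (-1)^{|A|-1} x_A
hashI : ∀ {n} (I : Subset n) → Point n I → ℚ
hashI I x = sumSub (λ T → sub? T I ∧ does (2 ℕ.≤? ∣ T ∣)) (λ T → sgn ∣ T ∣ * xS x T)

forkedLHS : ∀ {n} (I : Subset n) → Point n I → ℚ
forkedLHS {n} I x =
  oneCI I x + sumList (λ u → 1ℚ + (- xB x u)) (filter (λ u → u ∈? I) (allFin n))

HoldsIneq : ∀ {n} (I : Subset n) → Ineq n → Point n I → Set
HoldsIneq I (star T)  x = 0ℚ Q.≤ starLHS T x
HoldsIneq I (bidir u) x = bidirLHS u x Q.≤ 1ℚ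
HoldsIneq I forked    x = forkedLHS I x Q.≤ 1ℚ + hashI I x

SatisfiesAll : ∀ {n} (I : Subset n) → Point n I → Set
SatisfiesAll {n} I x = (i : Ineq n) → ValidIneq I i → HoldsIneq I i x

IsHRep : ∀ {n} (I : Subset n) → Set
IsHRep {n} I = ∀ (x : Point n I) → InCIM I x ⇔ SatisfiesAll I x

IsIrredundant : ∀ {n} (I : Subset n) → Set
IsIrredundant {n} I =
  (i : Ineq n) → ValidIneq I i →
  ∃[ x ] (((j : Ineq n) → ValidIneq I j → j ≢ i → HoldsIneq I j x)
          × ¬ HoldsIneq I i x)

module Submission where

-- A vertex c_{𝒢^I} of CIM_S^I only depends on the set N of parents of the centre c, and by
-- Möbius inversion and inclusion–exclusion over the subsets of N each inequality evaluates there
-- to the indicator of a condition on N; in particular every inequality is valid on CIM_S^I.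
-- Taking, for each inequality, the vertex with N = T (star T), N = ⁅ u ⁆ (bidirected edge u)
-- or N = ∅ (forked tree) gives a dual basis: the slack of an inequality is 1 at its own vertex
-- and 0 at all the others.  The linear parts of the slacks determine a point (Möbius inversion
-- recovers the star coordinates, then the bidirected-edge and forked-tree inequalities recover the
-- rest), so every point is the affine combination of the chosen vertices with its slacks as
-- coefficients.  Hence the inequalities cut out exactly the simplex spanned by these vertices,
-- which is CIM_S^I; dropping one of them admits 2 v − v′, where v′ is its own vertex and v is the
-- vertex of another inequality.

open import Defs
open import Algebra.Bundles using (CommutativeMonoid)
open import Data.Bool using (Bool; true; false; T; _∧_; _∨_; not)
open import Data.Bool.ListAction using (all; any)
open import Data.Bool.Properties using (T-≡; T-∨; T-∧)
import Data.Bool.Properties as Bool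
open import Data.Empty using (⊥-elim)
open import Data.Fin as Fin using (Fin; zero; suc)
open import Data.Fin.Subset using (Subset; ∣_∣; _∈_; _⊆_; _⊂_; _∩_; _∪_; ⁅_⁆; ∁; ⊥; ⊤) renaming (_-_ to _∖_)
open import Data.Fin.Subset.Properties
  using ( _∈?_; _⊆?_; s⊆s; out⊆; p⊆q⇒∣p∣≤∣q∣; p⊂q⇒∣p∣<∣q∣; p⊆p∪q; x∈p∪q⁺; x∈p∪q⁻; x∈p∩q⁺; ∣p∩q∣≤∣p∣
        ; x∈⁅x⁆; x∈⁅y⁆⇒x≡y; x≢y⇒x∉⁅y⁆; ∣⁅x⁆∣≡1; x∈∁p⇒x∉p; ∉⊥; ∣⊥∣≡0; ∣⊤∣≡n; ∩-zeroʳ; ∩-inverseˡ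
        ; x∈p⇒∣p-x∣<∣p∣; ∩⇔× )
import Data.Integer as ℤ
import Data.Integer.Properties as ℤP
open import Data.List using (List; []; _∷_; map; filter; filterᵇ; _++_; tabulate; allFin; lookup; length)
open import Data.List.Membership.Propositional using (find) renaming (_∈_ to _∈ˡ_)
open import Data.List.Membership.Propositional.Properties
  using (∈-filter⁺; ∈-filter⁻; ∈-allFin; ∈-lookup; ∈-map⁺; ∈-map⁻; ∈-++⁺ˡ; ∈-++⁺ʳ; ∈-++⁻)
import Data.List.Relation.Unary.All as All
import Data.List.Relation.Unary.All.Properties as Allₚ
open import Data.List.Relation.Unary.AllPairs using ([]; _∷_)
import Data.List.Relation.Unary.Any as Any
open import Data.List.Relation.Unary.Any using (here; there)
import Data.List.Relation.Unary.Any.Properties as Anyₚ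
open import Data.List.Relation.Unary.Unique.Propositional using (Unique)
import Data.List.Relation.Unary.Unique.Propositional.Properties as Unique
open import Data.Nat as ℕ using (ℕ; zero; suc; _∸_; _≤_; _<_; z≤n; s≤s)
import Data.Nat.Coprimality as Coprimality
import Data.Nat.Properties as ℕP
open import Data.Product using (∃-syntax; _×_; _,_; proj₁; proj₂)
open import Data.Rational as ℚ using (ℚ; 0ℚ; 1ℚ; _+_; _*_; -_; _-_)
import Data.Rational.Properties as ℚP
open import Data.Rational.Solver using (module +-*-Solver)
import Data.Sign as Sign
open import Data.Sum using (inj₁; inj₂; [_,_])
open import Data.Unit using (tt)
import Data.Vec as Vec
open import Data.Vec using ([]; _∷_)
open import Data.Vec.Properties using (≡-dec; ∷-injectiveʳ; lookup∘tabulate; []=⇒lookup; lookup⇒[]=)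
open import Data.Vec.Properties.WithK using ([]=-irrelevant)
open import Function using (_∘_)
open import Function.Bundles using (_⇔_; mk⇔; Equivalence)
open import Relation.Binary.Definitions using (DecidableEquality)
open import Relation.Binary.PropositionalEquality
  using (_≡_; _≢_; refl; sym; trans; cong; cong₂; subst; subst₂; module ≡-Reasoning)
open import Relation.Nullary using (Dec; does; yes; no; ¬_)
open import Relation.Nullary.Decidable using (dec-true; dec-false; does-⇔; T?; _×-dec_)
open import Relation.Unary using (Pred; Decidable)

open import Algebra.Properties.Group ℚP.+-0-group
  using (x∙y⁻¹≈ε⇒x≈y) renaming (⁻¹-involutive to neg-involutive)
open import Algebra.Properties.CommutativeSemigroup
  (CommutativeMonoid.commutativeSemigroup ℚP.+-0-commutativeMonoid)
  using () renaming (interchange to +-interchange)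
open +-*-Solver

𝟙 : ∀ {p} {P : Set p} → Dec P → ℚ
𝟙 P? = b2q (does P?)

𝟙-yes : ∀ {p} {P : Set p} (P? : Dec P) → P → 𝟙 P? ≡ 1ℚ
𝟙-yes P? p = cong b2q (dec-true P? p)

𝟙-no : ∀ {p} {P : Set p} (P? : Dec P) → ¬ P → 𝟙 P? ≡ 0ℚ
𝟙-no P? ¬p = cong b2q (dec-false P? ¬p)

𝟙*≡0 : ∀ {p} {P : Set p} (P? : Dec P) {x} → (P → x ≡ 0ℚ) → 𝟙 P? * x ≡ 0ℚ
𝟙*≡0 (yes p) {x} x≡0 = trans (ℚP.*-identityˡ x) (x≡0 p)
𝟙*≡0 (no _)  {x} _   = ℚP.*-zeroˡ x

𝟙*-cong : ∀ {p} {P : Set p} (P? : Dec P) {x y} → (P → x ≡ y) → 𝟙 P? * x ≡ 𝟙 P? * y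
𝟙*-cong (yes p) x≡y = cong (1ℚ *_) (x≡y p)
𝟙*-cong (no _)  {x} {y} _ = trans (ℚP.*-zeroˡ x) (sym (ℚP.*-zeroˡ y))

b2q-∧ : ∀ a b → b2q (a ∧ b) ≡ b2q a * b2q b
b2q-∧ true  b = sym (ℚP.*-identityˡ (b2q b))
b2q-∧ false b = sym (ℚP.*-zeroˡ (b2q b))

b2q-complement : ∀ a → b2q a ≡ 1ℚ - b2q (not a)
b2q-complement true  = refl
b2q-complement false = refl

b2q-nonneg : ∀ a → 0ℚ ℚ.≤ b2q a
b2q-nonneg true  = ℚP.nonNegative⁻¹ 1ℚ
b2q-nonneg false = ℚP.≤-refl

neg≡-1* : ∀ q → - q ≡ (- 1ℚ) * q
neg≡-1* = solve 1 (λ q → :- q := con (- 1ℚ) :* q) refl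

sgn-suc : ∀ k → sgn (suc k) ≡ - sgn k
sgn-suc zero          = refl
sgn-suc (suc zero)    = refl
sgn-suc (suc (suc k)) = sgn-suc k

sgn-+ : ∀ a b → sgn (a ℕ.+ b) ≡ sgn a * sgn b
sgn-+ zero          b = sym (ℚP.*-identityˡ (sgn b))
sgn-+ (suc zero)    b = trans (sgn-suc b) (neg≡-1* (sgn b))
sgn-+ (suc (suc a)) b = sgn-+ a b

nat-suc : ∀ k → nat (suc k) ≡ 1ℚ + nat k
nat-suc k rewrite ℚP.normalize-coprime (Coprimality.sym (Coprimality.1-coprimeTo k)) =
  cong (λ z → (ℤ.+ 1 ℤ.+ z) ℚ./ 1) (sym (trans (cong (Sign.+ ℤ.◃_) (ℕP.*-identityʳ k)) (ℤP.+◃n≡+n k)))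

nonneg-* : ∀ {p q} → 0ℚ ℚ.≤ p → 0ℚ ℚ.≤ q → 0ℚ ℚ.≤ p * q
nonneg-* {p} {q} 0≤p 0≤q =
  subst (ℚ._≤ p * q) (ℚP.*-zeroˡ q) (ℚP.*-monoʳ-≤-nonNeg q {{ℚ.nonNegative 0≤q}} 0≤p)

p≤q⇔0≤q-p : ∀ {p q} → p ℚ.≤ q ⇔ 0ℚ ℚ.≤ q - p
p≤q⇔0≤q-p {p} {q} = mk⇔
  (λ p≤q → subst (ℚ._≤ q - p) (ℚP.+-inverseʳ p) (ℚP.+-monoˡ-≤ (- p) p≤q))
  (λ 0≤q-p → subst₂ ℚ._≤_ (ℚP.+-identityˡ p) (solve 2 (λ p q → (q :- p) :+ p := q) refl p q)
                     (ℚP.+-monoˡ-≤ p 0≤q-p))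

0≰-1 : ¬ (0ℚ ℚ.≤ - 1ℚ)
0≰-1 (ℚ.*≤* ())

module _ {a} {A : Set a} where

  sumList-cong : ∀ {f g : A → ℚ} xs → (∀ {x} → x ∈ˡ xs → f x ≡ g x) → sumList f xs ≡ sumList g xs
  sumList-cong []       f≗g = refl
  sumList-cong (x ∷ xs) f≗g = cong₂ _+_ (f≗g (here refl)) (sumList-cong xs (f≗g ∘ there))

  sumList-zero : ∀ {f : A → ℚ} xs → (∀ x → f x ≡ 0ℚ) → sumList f xs ≡ 0ℚ
  sumList-zero []       f≗0 = refl
  sumList-zero (x ∷ xs) f≗0 = cong₂ _+_ (f≗0 x) (sumList-zero xs f≗0)

  sumList-+ : ∀ (f g : A → ℚ) xs → sumList (λ x → f x + g x) xs ≡ sumList f xs + sumList g xs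
  sumList-+ f g []       = refl
  sumList-+ f g (x ∷ xs) = trans (cong (f x + g x +_) (sumList-+ f g xs))
    (+-interchange (f x) (g x) _ _)

  sumList-*ˡ : ∀ c (f : A → ℚ) xs → sumList (λ x → c * f x) xs ≡ c * sumList f xs
  sumList-*ˡ c f []       = sym (ℚP.*-zeroʳ c)
  sumList-*ˡ c f (x ∷ xs) =
    trans (cong (c * f x +_) (sumList-*ˡ c f xs)) (sym (ℚP.*-distribˡ-+ c (f x) _))

  sumList-neg : ∀ (f : A → ℚ) xs → sumList (λ x → - f x) xs ≡ - sumList f xs
  sumList-neg f xs = begin
    sumList (λ x → - f x) xs           ≡⟨ sumList-cong xs (λ {x} _ → neg≡-1* (f x)) ⟩
    sumList (λ x → (- 1ℚ) * f x) xs    ≡⟨ sumList-*ˡ (- 1ℚ) f xs ⟩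
    (- 1ℚ) * sumList f xs              ≡⟨ neg≡-1* (sumList f xs) ⟨
    - sumList f xs                     ∎
    where open ≡-Reasoning

  sumList-++ : ∀ (f : A → ℚ) xs ys → sumList f (xs ++ ys) ≡ sumList f xs + sumList f ys
  sumList-++ f []       ys = sym (ℚP.+-identityˡ _)
  sumList-++ f (x ∷ xs) ys = trans (cong (f x +_) (sumList-++ f xs ys)) (sym (ℚP.+-assoc (f x) _ _))

  sumList-filter : ∀ {p} {P : Pred A p} (P? : Decidable P) (f : A → ℚ) xs →
                   sumList f (filter P? xs) ≡ sumList (λ x → 𝟙 (P? x) * f x) xs
  sumList-filter P? f [] = refl
  sumList-filter P? f (x ∷ xs) with does (P? x)
  ... | true  = cong₂ _+_ (sym (ℚP.*-identityˡ (f x))) (sumList-filter P? f xs)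
  ... | false = trans (sumList-filter P? f xs)
                      (sym (trans (cong (_+ _) (ℚP.*-zeroˡ (f x))) (ℚP.+-identityˡ _)))

  sumList-tabulate : ∀ {m} (f : A → ℚ) (g : Fin m → A) → sumList f (tabulate g) ≡ sumFin (f ∘ g)
  sumList-tabulate {zero}  f g = refl
  sumList-tabulate {suc m} f g = cong (f (g zero) +_) (sumList-tabulate f (g ∘ suc))

sumList-map : ∀ {a b} {A : Set a} {B : Set b} (f : B → ℚ) (g : A → B) xs →
              sumList f (map g xs) ≡ sumList (f ∘ g) xs
sumList-map f g []       = refl
sumList-map f g (x ∷ xs) = cong (f (g x) +_) (sumList-map f g xs)

sumFin-cong : ∀ {m} {f g : Fin m → ℚ} → (∀ i → f i ≡ g i) → sumFin f ≡ sumFin g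
sumFin-cong {zero}  f≗g = refl
sumFin-cong {suc m} f≗g = cong₂ _+_ (f≗g zero) (sumFin-cong (f≗g ∘ suc))

sumFin-+ : ∀ {m} (f g : Fin m → ℚ) → sumFin (λ i → f i + g i) ≡ sumFin f + sumFin g
sumFin-+ {zero}  f g = refl
sumFin-+ {suc m} f g = trans (cong (f zero + g zero +_) (sumFin-+ (f ∘ suc) (g ∘ suc)))
  (+-interchange (f zero) (g zero) _ _)

sumFin-*ˡ : ∀ {m} c (f : Fin m → ℚ) → sumFin (λ i → c * f i) ≡ c * sumFin f
sumFin-*ˡ {zero}  c f = sym (ℚP.*-zeroʳ c)
sumFin-*ˡ {suc m} c f =
  trans (cong (c * f zero +_) (sumFin-*ˡ c (f ∘ suc))) (sym (ℚP.*-distribˡ-+ c (f zero) _))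

sumFin-- : ∀ {m} (f g : Fin m → ℚ) → sumFin (λ i → f i - g i) ≡ sumFin f - sumFin g
sumFin-- f g = begin
  sumFin (λ i → f i - g i)                  ≡⟨ sumFin-cong (λ i → cong (f i +_) (neg≡-1* (g i))) ⟩
  sumFin (λ i → f i + (- 1ℚ) * g i)          ≡⟨ sumFin-+ f (λ i → (- 1ℚ) * g i) ⟩
  sumFin f + sumFin (λ i → (- 1ℚ) * g i)     ≡⟨ cong (sumFin f +_) (sumFin-*ˡ (- 1ℚ) g) ⟩
  sumFin f + (- 1ℚ) * sumFin g               ≡⟨ cong (sumFin f +_) (neg≡-1* (sumFin g)) ⟨
  sumFin f - sumFin g                        ∎
  where open ≡-Reasoning

sumFin-nonneg : ∀ {m} (f : Fin m → ℚ) → (∀ i → 0ℚ ℚ.≤ f i) → 0ℚ ℚ.≤ sumFin f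
sumFin-nonneg {zero}  f 0≤f = ℚP.≤-refl
sumFin-nonneg {suc m} f 0≤f = ℚP.+-mono-≤ (0≤f zero) (sumFin-nonneg (f ∘ suc) (0≤f ∘ suc))

sumFin-zero : ∀ {m} {f : Fin m → ℚ} → (∀ i → f i ≡ 0ℚ) → sumFin f ≡ 0ℚ
sumFin-zero {zero}  f≗0 = refl
sumFin-zero {suc m} f≗0 = cong₂ _+_ (f≗0 zero) (sumFin-zero (f≗0 ∘ suc))

sumFin-δ : ∀ {m} (w : Fin m → ℚ) j → sumFin (λ i → w i * 𝟙 (j Fin.≟ i)) ≡ w j
sumFin-δ w zero = trans (cong₂ _+_ (ℚP.*-identityʳ (w zero)) (sumFin-zero (λ i → ℚP.*-zeroʳ (w (suc i)))))
                        (ℚP.+-identityʳ (w zero))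
sumFin-δ w (suc j) = trans (cong₂ _+_ (ℚP.*-zeroʳ (w zero)) (sumFin-δ (w ∘ suc) j))
                           (ℚP.+-identityˡ (w (suc j)))

sumFin-𝟙 : ∀ {m} (j : Fin m) → sumFin (λ i → 𝟙 (j Fin.≟ i)) ≡ 1ℚ
sumFin-𝟙 j = trans (sumFin-cong (λ i → sym (ℚP.*-identityˡ (𝟙 (j Fin.≟ i))))) (sumFin-δ (λ _ → 1ℚ) j)

lincomb : ∀ {K : Set} {m} → (Fin m → ℚ) → (Fin m → K → ℚ) → K → ℚ
lincomb w p κ = sumFin (λ i → w i * p i κ)

record Linear {K : Set} (L : (K → ℚ) → ℚ) : Set where
  field
    resp-≗      : ∀ {x y} → (∀ κ → x κ ≡ y κ) → L x ≡ L y
    additive    : ∀ x y → L (λ κ → x κ + y κ) ≡ L x + L y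
    homogeneous : ∀ a x → L (λ κ → a * x κ) ≡ a * L x

  zero-preserving : L (λ _ → 0ℚ) ≡ 0ℚ
  zero-preserving = begin
    L (λ _ → 0ℚ)        ≡⟨ resp-≗ {y = λ _ → 0ℚ * 0ℚ} (λ _ → sym (ℚP.*-zeroˡ 0ℚ)) ⟩
    L (λ _ → 0ℚ * 0ℚ)   ≡⟨ homogeneous 0ℚ (λ _ → 0ℚ) ⟩
    0ℚ * L (λ _ → 0ℚ)   ≡⟨ ℚP.*-zeroˡ (L (λ _ → 0ℚ)) ⟩
    0ℚ                  ∎
    where open ≡-Reasoning

  subtractive : ∀ x y → L (λ κ → x κ - y κ) ≡ L x - L y
  subtractive x y = begin
    L (λ κ → x κ - y κ)              ≡⟨ resp-≗ (λ κ → cong (x κ +_) (neg≡-1* (y κ))) ⟩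
    L (λ κ → x κ + (- 1ℚ) * y κ)     ≡⟨ additive x _ ⟩
    L x + L (λ κ → (- 1ℚ) * y κ)     ≡⟨ cong (L x +_) (homogeneous (- 1ℚ) y) ⟩
    L x + (- 1ℚ) * L y               ≡⟨ cong (L x +_) (neg≡-1* (L y)) ⟨
    L x - L y                        ∎
    where open ≡-Reasoning

  preserves-lincomb : ∀ {m} (w : Fin m → ℚ) p → L (lincomb w p) ≡ sumFin (λ i → w i * L (p i))
  preserves-lincomb {zero}  w p = zero-preserving
  preserves-lincomb {suc m} w p = begin
    L (λ κ → w zero * p zero κ + lincomb (w ∘ suc) (p ∘ suc) κ)
      ≡⟨ additive _ _ ⟩
    L (λ κ → w zero * p zero κ) + L (lincomb (w ∘ suc) (p ∘ suc))
      ≡⟨ cong₂ _+_ (homogeneous (w zero) (p zero)) (preserves-lincomb (w ∘ suc) (p ∘ suc)) ⟩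
    w zero * L (p zero) + sumFin (λ i → w (suc i) * L (p (suc i)))
      ∎
    where open ≡-Reasoning

  affine-lincomb : ∀ c {m} (w : Fin m → ℚ) p → sumFin w ≡ 1ℚ →
                   c + L (lincomb w p) ≡ sumFin (λ i → w i * (c + L (p i)))
  affine-lincomb c w p Σw≡1 = begin
    c + L (lincomb w p)                                      ≡⟨ cong₂ _+_ c≡ (preserves-lincomb w p) ⟩
    sumFin (λ i → c * w i) + sumFin (λ i → w i * L (p i))    ≡⟨ sumFin-+ (λ i → c * w i) (λ i → w i * L (p i)) ⟨
    sumFin (λ i → c * w i + w i * L (p i))                   ≡⟨ sumFin-cong (λ i → solve 3 (λ c w l → c :* w :+ w :* l := w :* (c :+ l)) refl c (w i) (L (p i))) ⟩
    sumFin (λ i → w i * (c + L (p i)))                       ∎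
    where
    open ≡-Reasoning
    c≡ : c ≡ sumFin (λ i → c * w i)
    c≡ = sym (trans (sumFin-*ˡ c w) (trans (cong (c *_) Σw≡1) (ℚP.*-identityʳ c)))

open Linear public

module _ {K : Set} where

  Linear-*ˡ : ∀ a {L : (K → ℚ) → ℚ} → Linear L → Linear (λ x → a * L x)
  Linear-*ˡ a lin = record
    { resp-≗      = λ x≗y → cong (a *_) (resp-≗ lin x≗y)
    ; additive    = λ x y → trans (cong (a *_) (additive lin x y)) (ℚP.*-distribˡ-+ a _ _)
    ; homogeneous = λ b x → trans (cong (a *_) (homogeneous lin b x))
                                  (solve 3 (λ a b l → a :* (b :* l) := b :* (a :* l)) refl a b _)
    }

  Linear-+ : ∀ {L M : (K → ℚ) → ℚ} → Linear L → Linear M → Linear (λ x → L x + M x)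
  Linear-+ {L} {M} linL linM = record
    { resp-≗      = λ x≗y → cong₂ _+_ (resp-≗ linL x≗y) (resp-≗ linM x≗y)
    ; additive    = λ x y → trans (cong₂ _+_ (additive linL x y) (additive linM x y))
        (+-interchange (L x) (L y) (M x) (M y))
    ; homogeneous = λ a x → trans (cong₂ _+_ (homogeneous linL a x) (homogeneous linM a x))
                                  (sym (ℚP.*-distribˡ-+ a _ _))
    }

  Linear-neg : ∀ {L : (K → ℚ) → ℚ} → Linear L → Linear (λ x → - L x)
  Linear-neg {L} lin = record
    { resp-≗      = λ x≗y → cong -_ (resp-≗ lin x≗y)
    ; additive    = λ x y → trans (cong -_ (additive lin x y)) (ℚP.neg-distrib-+ (L x) (L y))
    ; homogeneous = λ a x → trans (cong -_ (homogeneous lin a x)) (ℚP.neg-distribʳ-* a _)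
    }

  Linear-at : ∀ (κ : K) → Linear (λ x → x κ)
  Linear-at κ = record
    { resp-≗      = λ x≗y → x≗y κ
    ; additive    = λ _ _ → refl
    ; homogeneous = λ _ _ → refl
    }

  Linear-zero : Linear {K} (λ _ → 0ℚ)
  Linear-zero = record
    { resp-≗      = λ _ → refl
    ; additive    = λ _ _ → sym (ℚP.+-identityˡ 0ℚ)
    ; homogeneous = λ a _ → sym (ℚP.*-zeroʳ a)
    }

  Linear-sumList : ∀ {a} {A : Set a} (L : A → (K → ℚ) → ℚ) xs →
                   (∀ y → Linear (L y)) → Linear (λ x → sumList (λ y → L y x) xs)
  Linear-sumList L xs lin = record
    { resp-≗      = λ x≗y → sumList-cong xs (λ {y} _ → resp-≗ (lin y) x≗y)
    ; additive    = λ x x′ → trans (sumList-cong xs (λ {y} _ → additive (lin y) x x′))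
                                   (sumList-+ (λ y → L y x) (λ y → L y x′) xs)
    ; homogeneous = λ a x → trans (sumList-cong xs (λ {y} _ → homogeneous (lin y) a x))
                                  (sumList-*ˡ a (λ y → L y x) xs)
    }

-- The slacks s j = c j + L j are affine and the points v are dual to them: s j (v k) = δ j k.
-- If (d , t) ↦ (L j d − c j t) j is injective, the slacks are affine coordinates: every x is the
-- combination of the v k with the coefficients s k x, and these sum to 1.
module DualBasis {n} {I : Subset n} {m}
  (c : Fin m → ℚ) (L : Fin m → Point n I → ℚ) (L-linear : ∀ j → Linear (L j))
  (v : Fin m → Point n I)
  (dual : ∀ j k → c j + L j (v k) ≡ 𝟙 (j Fin.≟ k))
  (injective : ∀ d t → (∀ j → L j d ≡ c j * t) → t ≡ 0ℚ × (∀ κ → d κ ≡ 0ℚ))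
  where

  s : Fin m → Point n I → ℚ
  s j x = c j + L j x

  L-lincomb : ∀ w j → L j (lincomb w v) ≡ w j - c j * sumFin w
  L-lincomb w j = begin
    L j (lincomb w v)                                           ≡⟨ preserves-lincomb (L-linear j) w v ⟩
    sumFin (λ k → w k * L j (v k))                              ≡⟨ sumFin-cong (λ k → cong (w k *_) (L≡ k)) ⟩
    sumFin (λ k → w k * (𝟙 (j Fin.≟ k) - c j))                  ≡⟨ sumFin-cong (λ k → distrib (w k) _ (c j)) ⟩
    sumFin (λ k → w k * 𝟙 (j Fin.≟ k) + (- c j) * w k)          ≡⟨ sumFin-+ (λ k → w k * 𝟙 (j Fin.≟ k)) (λ k → (- c j) * w k) ⟩
    sumFin (λ k → w k * 𝟙 (j Fin.≟ k)) + sumFin (λ k → (- c j) * w k) ≡⟨ cong₂ _+_ (sumFin-δ w j) (sumFin-*ˡ (- c j) w) ⟩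
    w j + (- c j) * sumFin w                                    ≡⟨ cong (w j +_) (ℚP.neg-distribˡ-* (c j) _) ⟨
    w j - c j * sumFin w                                        ∎
    where
    open ≡-Reasoning
    L≡ : ∀ k → L j (v k) ≡ 𝟙 (j Fin.≟ k) - c j
    L≡ k = trans (solve 2 (λ c l → l := (c :+ l) :- c) refl (c j) (L j (v k))) (cong (_- c j) (dual j k))
    distrib : ∀ w δ c → w * (δ - c) ≡ w * δ + (- c) * w
    distrib = solve 3 (λ w δ c → w :* (δ :- c) := w :* δ :+ (:- c) :* w) refl

  s-lincomb : ∀ w → sumFin w ≡ 1ℚ → ∀ j → s j (lincomb w v) ≡ w j
  s-lincomb w Σw≡1 j = begin
    c j + L j (lincomb w v)        ≡⟨ cong (c j +_) (L-lincomb w j) ⟩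
    c j + (w j - c j * sumFin w)   ≡⟨ cong (λ σ → c j + (w j - c j * σ)) Σw≡1 ⟩
    c j + (w j - c j * 1ℚ)         ≡⟨ solve 2 (λ c w → c :+ (w :- c :* con 1ℚ) := w) refl (c j) (w j) ⟩
    w j                            ∎
    where open ≡-Reasoning

  reconstruct : ∀ x → sumFin (λ j → s j x) ≡ 1ℚ × (∀ κ → x κ ≡ lincomb (λ j → s j x) v κ)
  reconstruct x = x∙y⁻¹≈ε⇒x≈y _ _ (proj₁ d≡0) , λ κ → x∙y⁻¹≈ε⇒x≈y _ _ (proj₂ d≡0 κ)
    where
    w : Fin m → ℚ
    w j = s j x
    d≡0 = injective (λ κ → x κ - lincomb w v κ) (sumFin w - 1ℚ) λ j → begin
      L j (λ κ → x κ - lincomb w v κ)    ≡⟨ subtractive (L-linear j) x (lincomb w v) ⟩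
      L j x - L j (lincomb w v)          ≡⟨ cong (λ z → L j x - z) (L-lincomb w j) ⟩
      L j x - ((c j + L j x) - c j * sumFin w)
        ≡⟨ solve 3 (λ l c σ → l :- ((c :+ l) :- c :* σ) := c :* (σ :- con 1ℚ)) refl (L j x) (c j) (sumFin w) ⟩
      c j * (sumFin w - 1ℚ)              ∎
      where open ≡-Reasoning

  nonneg⇔InConv : ∀ x → (∀ j → 0ℚ ℚ.≤ s j x) ⇔ InConv v x
  nonneg⇔InConv x = mk⇔
    (λ 0≤s → (λ j → s j x) , 0≤s , reconstruct x)
    (λ { (w , 0≤w , Σw≡1 , x≡) j →
           subst (0ℚ ℚ.≤_) (sym (trans (cong (c j +_) (resp-≗ (L-linear j) x≡)) (s-lincomb w Σw≡1 j)))
                 (0≤w j) })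

  affinelyIndependent : AffinelyIndependent v
  affinelyIndependent l Σl≡0 lincomb≡0 j = begin
    l j                       ≡⟨ solve 2 (λ l c → l := l :- c :* con 0ℚ) refl (l j) (c j) ⟩
    l j - c j * 0ℚ            ≡⟨ cong (λ σ → l j - c j * σ) Σl≡0 ⟨
    l j - c j * sumFin l      ≡⟨ L-lincomb l j ⟨
    L j (lincomb l v)         ≡⟨ resp-≗ (L-linear j) lincomb≡0 ⟩
    L j (λ _ → 0ℚ)            ≡⟨ zero-preserving (L-linear j) ⟩
    0ℚ                        ∎
    where open ≡-Reasoning

  irredundant : ∀ {j k} → k ≢ j → ∃[ x ] ((∀ i → i ≢ j → 0ℚ ℚ.≤ s i x) × ¬ (0ℚ ℚ.≤ s j x))
  irredundant {j} {k} k≢j = lincomb a v , s≥0 , s[j]≱0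
    where
    open ≡-Reasoning
    a : Fin m → ℚ
    a i = 𝟙 (k Fin.≟ i) + (𝟙 (k Fin.≟ i) - 𝟙 (j Fin.≟ i))
    Σa≡1 : sumFin a ≡ 1ℚ
    Σa≡1 = begin
      sumFin a
        ≡⟨ sumFin-+ (λ i → 𝟙 (k Fin.≟ i)) (λ i → 𝟙 (k Fin.≟ i) - 𝟙 (j Fin.≟ i)) ⟩
      sumFin (λ i → 𝟙 (k Fin.≟ i)) + sumFin (λ i → 𝟙 (k Fin.≟ i) - 𝟙 (j Fin.≟ i))
        ≡⟨ cong (sumFin (λ i → 𝟙 (k Fin.≟ i)) +_) (sumFin-- (λ i → 𝟙 (k Fin.≟ i)) (λ i → 𝟙 (j Fin.≟ i))) ⟩
      sumFin (λ i → 𝟙 (k Fin.≟ i)) + (sumFin (λ i → 𝟙 (k Fin.≟ i)) - sumFin (λ i → 𝟙 (j Fin.≟ i)))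
        ≡⟨ cong₂ (λ p q → p + (p - q)) (sumFin-𝟙 k) (sumFin-𝟙 j) ⟩
      1ℚ + (1ℚ - 1ℚ)
        ≡⟨ cong (1ℚ +_) (ℚP.+-inverseʳ 1ℚ) ⟩
      1ℚ + 0ℚ
        ≡⟨ ℚP.+-identityʳ 1ℚ ⟩
      1ℚ ∎
    s≥0 : ∀ i → i ≢ j → 0ℚ ℚ.≤ s i (lincomb a v)
    s≥0 i i≢j = subst (0ℚ ℚ.≤_) (sym s≡) (ℚP.+-mono-≤ (b2q-nonneg (does (k Fin.≟ i))) (b2q-nonneg (does (k Fin.≟ i))))
      where
      s≡ : s i (lincomb a v) ≡ 𝟙 (k Fin.≟ i) + 𝟙 (k Fin.≟ i)
      s≡ = begin
        s i (lincomb a v)                                       ≡⟨ s-lincomb a Σa≡1 i ⟩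
        𝟙 (k Fin.≟ i) + (𝟙 (k Fin.≟ i) - 𝟙 (j Fin.≟ i))         ≡⟨ cong (λ z → 𝟙 (k Fin.≟ i) + (𝟙 (k Fin.≟ i) - z)) (𝟙-no (j Fin.≟ i) (i≢j ∘ sym)) ⟩
        𝟙 (k Fin.≟ i) + (𝟙 (k Fin.≟ i) - 0ℚ)                    ≡⟨ cong (𝟙 (k Fin.≟ i) +_) (ℚP.+-identityʳ (𝟙 (k Fin.≟ i))) ⟩
        𝟙 (k Fin.≟ i) + 𝟙 (k Fin.≟ i)                           ∎
    s[j]≡-1 : s j (lincomb a v) ≡ - 1ℚ
    s[j]≡-1 = begin
      s j (lincomb a v)                                 ≡⟨ s-lincomb a Σa≡1 j ⟩
      𝟙 (k Fin.≟ j) + (𝟙 (k Fin.≟ j) - 𝟙 (j Fin.≟ j))   ≡⟨ cong₂ (λ p q → p + (p - q)) (𝟙-no (k Fin.≟ j) k≢j) (𝟙-yes (j Fin.≟ j) refl) ⟩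
      0ℚ + (0ℚ - 1ℚ)                                    ≡⟨ trans (ℚP.+-identityˡ _) (ℚP.+-identityˡ _) ⟩
      - 1ℚ                                              ∎
    s[j]≱0 : ¬ (0ℚ ℚ.≤ s j (lincomb a v))
    s[j]≱0 0≤s = 0≰-1 (subst (0ℚ ℚ.≤_) s[j]≡-1 0≤s)

∑⊆ : ∀ {n} → Subset n → (Subset n → ℚ) → ℚ
∑⊆ []          f = f []
∑⊆ (true ∷ M)  f = ∑⊆ M (f ∘ (true ∷_)) + ∑⊆ M (f ∘ (false ∷_))
∑⊆ (false ∷ M) f = ∑⊆ M (f ∘ (false ∷_))

syntax ∑⊆ M (λ A → e) = ∑[ A ⊆ M ] e

∑⊇ : ∀ {n} → Subset n → (Subset n → ℚ) → ℚ
∑⊇ []          f = f []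
∑⊇ (true ∷ T)  f = ∑⊇ T (f ∘ (true ∷_))
∑⊇ (false ∷ T) f = ∑⊇ T (f ∘ (true ∷_)) + ∑⊇ T (f ∘ (false ∷_))

syntax ∑⊇ T (λ U → e) = ∑[ U ⊇ T ] e

∑⊆-cong : ∀ {n} (M : Subset n) {f g} → (∀ A → A ⊆ M → f A ≡ g A) → ∑⊆ M f ≡ ∑⊆ M g
∑⊆-cong []          f≗g = f≗g [] (λ ())
∑⊆-cong (true ∷ M)  f≗g = cong₂ _+_ (∑⊆-cong M (λ A → f≗g _ ∘ s⊆s)) (∑⊆-cong M (λ A → f≗g _ ∘ out⊆))
∑⊆-cong (false ∷ M) f≗g = ∑⊆-cong M (λ A → f≗g _ ∘ out⊆)

∑⊆-zero : ∀ {n} (M : Subset n) {f} → (∀ A → f A ≡ 0ℚ) → ∑⊆ M f ≡ 0ℚ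
∑⊆-zero []          f≗0 = f≗0 []
∑⊆-zero (true ∷ M)  f≗0 = cong₂ _+_ (∑⊆-zero M (f≗0 ∘ (true ∷_))) (∑⊆-zero M (f≗0 ∘ (false ∷_)))
∑⊆-zero (false ∷ M) f≗0 = ∑⊆-zero M (f≗0 ∘ (false ∷_))

∑⊆-+ : ∀ {n} (M : Subset n) f g → ∑[ A ⊆ M ] (f A + g A) ≡ ∑⊆ M f + ∑⊆ M g
∑⊆-+ []          f g = refl
∑⊆-+ (true ∷ M)  f g = trans (cong₂ _+_ (∑⊆-+ M _ _) (∑⊆-+ M _ _))
  (+-interchange (∑⊆ M (f ∘ (true ∷_))) (∑⊆ M (g ∘ (true ∷_))) (∑⊆ M (f ∘ (false ∷_))) (∑⊆ M (g ∘ (false ∷_))))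
∑⊆-+ (false ∷ M) f g = ∑⊆-+ M _ _

∑⊆-*ˡ : ∀ {n} (M : Subset n) a f → ∑[ A ⊆ M ] (a * f A) ≡ a * ∑⊆ M f
∑⊆-*ˡ []          a f = refl
∑⊆-*ˡ (true ∷ M)  a f = trans (cong₂ _+_ (∑⊆-*ˡ M a _) (∑⊆-*ˡ M a _))
  (sym (ℚP.*-distribˡ-+ a (∑⊆ M (f ∘ (true ∷_))) (∑⊆ M (f ∘ (false ∷_)))))
∑⊆-*ˡ (false ∷ M) a f = ∑⊆-*ˡ M a _

∑⊆-neg : ∀ {n} (M : Subset n) f → ∑[ A ⊆ M ] (- f A) ≡ - ∑⊆ M f
∑⊆-neg []          f = refl
∑⊆-neg (true ∷ M)  f = trans (cong₂ _+_ (∑⊆-neg M _) (∑⊆-neg M _))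
  (sym (ℚP.neg-distrib-+ (∑⊆ M (f ∘ (true ∷_))) (∑⊆ M (f ∘ (false ∷_)))))
∑⊆-neg (false ∷ M) f = ∑⊆-neg M _

∑⊆-∩ : ∀ {n} (M N : Subset n) f → ∑[ A ⊆ M ] (b2q (sub? A N) * f A) ≡ ∑⊆ (M ∩ N) f
∑⊆-∩ []          []          f = ℚP.*-identityˡ (f [])
∑⊆-∩ (true ∷ M)  (true ∷ N)  f = cong₂ _+_ (∑⊆-∩ M N _) (∑⊆-∩ M N _)
∑⊆-∩ (true ∷ M)  (false ∷ N) f =
  trans (cong₂ _+_ (∑⊆-zero M (λ A → ℚP.*-zeroˡ (f (true ∷ A)))) (∑⊆-∩ M N _)) (ℚP.+-identityˡ _)
∑⊆-∩ (false ∷ M) (_ ∷ N)     f = ∑⊆-∩ M N _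

∑⊇-cong : ∀ {n} (T : Subset n) {f g} → (∀ U → T ⊆ U → f U ≡ g U) → ∑⊇ T f ≡ ∑⊇ T g
∑⊇-cong []          f≗g = f≗g [] (λ ())
∑⊇-cong (true ∷ T)  f≗g = ∑⊇-cong T (λ U → f≗g _ ∘ s⊆s)
∑⊇-cong (false ∷ T) f≗g = cong₂ _+_ (∑⊇-cong T (λ U → f≗g _ ∘ out⊆)) (∑⊇-cong T (λ U → f≗g _ ∘ out⊆))

∑⊇-zero : ∀ {n} (T : Subset n) {f} → (∀ U → f U ≡ 0ℚ) → ∑⊇ T f ≡ 0ℚ
∑⊇-zero []          f≗0 = f≗0 []
∑⊇-zero (true ∷ T)  f≗0 = ∑⊇-zero T (f≗0 ∘ (true ∷_))
∑⊇-zero (false ∷ T) f≗0 = cong₂ _+_ (∑⊇-zero T (f≗0 ∘ (true ∷_))) (∑⊇-zero T (f≗0 ∘ (false ∷_)))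

∑⊇-neg : ∀ {n} (T : Subset n) f → ∑[ U ⊇ T ] (- f U) ≡ - ∑⊇ T f
∑⊇-neg []          f = refl
∑⊇-neg (true ∷ T)  f = ∑⊇-neg T _
∑⊇-neg (false ∷ T) f = trans (cong₂ _+_ (∑⊇-neg T _) (∑⊇-neg T _))
  (sym (ℚP.neg-distrib-+ (∑⊇ T (f ∘ (true ∷_))) (∑⊇ T (f ∘ (false ∷_)))))

sumList-allSubsets : ∀ {n} (f : Subset (suc n) → ℚ) →
  sumList f (allSubsets (suc n)) ≡ sumList (f ∘ (true ∷_)) (allSubsets n) + sumList (f ∘ (false ∷_)) (allSubsets n)
sumList-allSubsets {n} f = trans (sumList-++ f (map (true ∷_) (allSubsets n)) _)
  (cong₂ _+_ (sumList-map f (true ∷_) (allSubsets n)) (sumList-map f (false ∷_) (allSubsets n)))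

sumList-⊆ : ∀ {n} (M : Subset n) f → sumList (λ A → b2q (sub? A M) * f A) (allSubsets n) ≡ ∑⊆ M f
sumList-⊆ []          f = trans (ℚP.+-identityʳ _) (ℚP.*-identityˡ (f []))
sumList-⊆ (true ∷ M)  f = trans (sumList-allSubsets (λ A → b2q (sub? A (true ∷ M)) * f A)) (cong₂ _+_ (sumList-⊆ M _) (sumList-⊆ M _))
sumList-⊆ {suc n} (false ∷ M) f = trans (sumList-allSubsets (λ A → b2q (sub? A (false ∷ M)) * f A))
  (trans (cong₂ _+_ (sumList-zero (allSubsets n) (λ A → ℚP.*-zeroˡ (f (true ∷ A)))) (sumList-⊆ M _))
         (ℚP.+-identityˡ _))

sumList-⊇ : ∀ {n} (T : Subset n) f → sumList (λ U → b2q (sub? T U) * f U) (allSubsets n) ≡ ∑⊇ T f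
sumList-⊇ []          f = trans (ℚP.+-identityʳ _) (ℚP.*-identityˡ (f []))
sumList-⊇ {suc n} (true ∷ T)  f = trans (sumList-allSubsets (λ U → b2q (sub? (true ∷ T) U) * f U))
  (trans (cong₂ _+_ (sumList-⊇ T _) (sumList-zero (allSubsets n) (λ U → ℚP.*-zeroˡ (f (false ∷ U))))) (ℚP.+-identityʳ _))
sumList-⊇ (false ∷ T) f = trans (sumList-allSubsets (λ U → b2q (sub? (false ∷ T) U) * f U)) (cong₂ _+_ (sumList-⊇ T _) (sumList-⊇ T _))

sumSub≡sumList : ∀ {n} (P : Subset n → Bool) (f : Subset n → ℚ) → sumSub P f ≡ sumList (λ A → b2q (P A) * f A) (allSubsets n)
sumSub≡sumList {n} P f = sumList-filter (T? ∘ P) f (allSubsets n)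

sumSub-⊆ : ∀ {n} (M : Subset n) (f : Subset n → ℚ) → sumSub (λ A → sub? A M) f ≡ ∑⊆ M f
sumSub-⊆ M f = trans (sumSub≡sumList (λ A → sub? A M) f) (sumList-⊆ M f)

sumSub-⊆∧ : ∀ {n} (M : Subset n) (P : Subset n → Bool) (f : Subset n → ℚ) → sumSub (λ A → sub? A M ∧ P A) f ≡ ∑[ A ⊆ M ] (b2q (P A) * f A)
sumSub-⊆∧ {n} M P f = begin
  sumSub (λ A → sub? A M ∧ P A) f                                          ≡⟨ sumSub≡sumList (λ A → sub? A M ∧ P A) f ⟩
  sumList (λ A → b2q (sub? A M ∧ P A) * f A) (allSubsets n)                 ≡⟨ sumList-cong (allSubsets n) (λ {A} _ → split A) ⟩
  sumList (λ A → b2q (sub? A M) * (b2q (P A) * f A)) (allSubsets n)         ≡⟨ sumList-⊆ M (λ A → b2q (P A) * f A) ⟩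
  ∑[ A ⊆ M ] (b2q (P A) * f A)                                             ∎
  where
  open ≡-Reasoning
  split : ∀ A → b2q (sub? A M ∧ P A) * f A ≡ b2q (sub? A M) * (b2q (P A) * f A)
  split A = trans (cong (_* f A) (b2q-∧ (sub? A M) (P A))) (ℚP.*-assoc (b2q (sub? A M)) (b2q (P A)) (f A))

sumSub-⊇ : ∀ {n} (T : Subset n) (f : Subset n → ℚ) → sumSub (sub? T) f ≡ ∑⊇ T f
sumSub-⊇ T f = trans (sumSub≡sumList (sub? T) f) (sumList-⊇ T f)

-- Möbius inversion and inclusion–exclusion

_≟ₛ_ : ∀ {n} → DecidableEquality (Subset n)
_≟ₛ_ = ≡-dec Bool._≟_

möbius : ∀ {n} → (Subset n → ℚ) → Subset n → ℚ
möbius y T = ∑[ U ⊇ T ] (sgn (∣ U ∣ ∸ ∣ T ∣) * y U)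

möbius-zero : ∀ {n} (T : Subset n) {y} → (∀ U → y U ≡ 0ℚ) → möbius y T ≡ 0ℚ
möbius-zero T y≗0 = ∑⊇-zero T (λ U → trans (cong (sgn (∣ U ∣ ∸ ∣ T ∣) *_) (y≗0 U)) (ℚP.*-zeroʳ (sgn (∣ U ∣ ∸ ∣ T ∣))))

möbius-false : ∀ {n} (T : Subset n) y →
               möbius y (false ∷ T) ≡ - möbius (y ∘ (true ∷_)) T + möbius (y ∘ (false ∷_)) T
möbius-false T y = cong (_+ möbius (y ∘ (false ∷_)) T) (begin
  ∑[ U ⊇ T ] (sgn (suc ∣ U ∣ ∸ ∣ T ∣) * y (true ∷ U))    ≡⟨ ∑⊇-cong T flip ⟩
  ∑[ U ⊇ T ] (- (sgn (∣ U ∣ ∸ ∣ T ∣) * y (true ∷ U)))    ≡⟨ ∑⊇-neg T (λ U → sgn (∣ U ∣ ∸ ∣ T ∣) * y (true ∷ U)) ⟩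
  - möbius (y ∘ (true ∷_)) T                            ∎)
  where
  open ≡-Reasoning
  flip : ∀ U → T ⊆ U → sgn (suc ∣ U ∣ ∸ ∣ T ∣) * y (true ∷ U) ≡ - (sgn (∣ U ∣ ∸ ∣ T ∣) * y (true ∷ U))
  flip U T⊆U = begin
    sgn (suc ∣ U ∣ ∸ ∣ T ∣) * y (true ∷ U)      ≡⟨ cong (λ k → sgn k * y (true ∷ U)) (ℕP.+-∸-assoc 1 (p⊆q⇒∣p∣≤∣q∣ T⊆U)) ⟩
    sgn (suc (∣ U ∣ ∸ ∣ T ∣)) * y (true ∷ U)    ≡⟨ cong (_* y (true ∷ U)) (sgn-suc (∣ U ∣ ∸ ∣ T ∣)) ⟩
    - sgn (∣ U ∣ ∸ ∣ T ∣) * y (true ∷ U)        ≡⟨ ℚP.neg-distribˡ-* (sgn (∣ U ∣ ∸ ∣ T ∣)) (y (true ∷ U)) ⟨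
    - (sgn (∣ U ∣ ∸ ∣ T ∣) * y (true ∷ U))      ∎

-- Generalised over the size threshold k below which y vanishes: on the sets containing the first
-- element the threshold drops by one, which makes splitting off that element an induction.
möbius-injective : ∀ {n} k (y : Subset n → ℚ) →
                   (∀ U → ∣ U ∣ < k → y U ≡ 0ℚ) → (∀ T → k ≤ ∣ T ∣ → möbius y T ≡ 0ℚ) →
                   ∀ U → y U ≡ 0ℚ
möbius-injective {zero} zero    y small large [] = trans (sym (ℚP.*-identityˡ (y []))) (large [] z≤n)
möbius-injective {zero} (suc k) y small large [] = small [] (s≤s z≤n)
möbius-injective {suc n} k y small large = y≗0
  where
  open ≡-Reasoning
  <pred⇒suc< : ∀ k {a} → a < ℕ.pred k → suc a < k
  <pred⇒suc< (suc k) a<k = s≤s a<k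
  pred≤⇒≤suc : ∀ k {a} → ℕ.pred k ≤ a → k ≤ suc a
  pred≤⇒≤suc zero    _   = z≤n
  pred≤⇒≤suc (suc k) k≤a = s≤s k≤a
  y-true : ∀ U → y (true ∷ U) ≡ 0ℚ
  y-true = möbius-injective (ℕ.pred k) (y ∘ (true ∷_))
    (λ U ∣U∣<k-1 → small (true ∷ U) (<pred⇒suc< k ∣U∣<k-1))
    (λ T k-1≤∣T∣ → large (true ∷ T) (pred≤⇒≤suc k k-1≤∣T∣))
  y-false : ∀ U → y (false ∷ U) ≡ 0ℚ
  y-false = möbius-injective k (y ∘ (false ∷_)) (small ∘ (false ∷_)) λ T k≤∣T∣ → begin
    möbius (y ∘ (false ∷_)) T                                ≡⟨ ℚP.+-identityˡ _ ⟨
    0ℚ + möbius (y ∘ (false ∷_)) T                           ≡⟨ cong (λ z → - z + möbius (y ∘ (false ∷_)) T) (möbius-zero T y-true) ⟨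
    - möbius (y ∘ (true ∷_)) T + möbius (y ∘ (false ∷_)) T   ≡⟨ möbius-false T y ⟨
    möbius y (false ∷ T)                                     ≡⟨ large (false ∷ T) k≤∣T∣ ⟩
    0ℚ                                                       ∎
  y≗0 : ∀ U → y U ≡ 0ℚ
  y≗0 (true ∷ U)  = y-true U
  y≗0 (false ∷ U) = y-false U

möbius-⊆ : ∀ {n} (T N : Subset n) → möbius (λ U → b2q (sub? U N)) T ≡ 𝟙 (T ≟ₛ N)
möbius-⊆ []          []          = refl
möbius-⊆ (true ∷ T)  (true ∷ N)  = möbius-⊆ T N
möbius-⊆ (true ∷ T)  (false ∷ N) = möbius-zero T (λ _ → refl)
möbius-⊆ (false ∷ T) (true ∷ N)  =
  trans (möbius-false T (λ U → b2q (sub? U (true ∷ N)))) (ℚP.+-inverseˡ (möbius (λ U → b2q (sub? U N)) T))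
möbius-⊆ (false ∷ T) (false ∷ N) = begin
  möbius (λ U → b2q (sub? U (false ∷ N))) (false ∷ T)         ≡⟨ möbius-false T (λ U → b2q (sub? U (false ∷ N))) ⟩
  - möbius (λ _ → 0ℚ) T + möbius (λ U → b2q (sub? U N)) T      ≡⟨ cong (λ z → - z + möbius (λ U → b2q (sub? U N)) T) (möbius-zero T (λ _ → refl)) ⟩
  0ℚ + möbius (λ U → b2q (sub? U N)) T                         ≡⟨ ℚP.+-identityˡ _ ⟩
  möbius (λ U → b2q (sub? U N)) T                              ≡⟨ möbius-⊆ T N ⟩
  𝟙 (T ≟ₛ N)                                                   ∎
  where open ≡-Reasoning

∑⊆-sgn : ∀ {n} (M : Subset n) → ∑[ A ⊆ M ] sgn ∣ A ∣ ≡ 𝟙 (∣ M ∣ ℕ.≟ 0)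
∑⊆-sgn []          = refl
∑⊆-sgn (true ∷ M)  = begin
  ∑[ A ⊆ M ] sgn (suc ∣ A ∣) + Σ   ≡⟨ cong (_+ Σ) (∑⊆-cong M (λ A _ → sgn-suc ∣ A ∣)) ⟩
  ∑[ A ⊆ M ] (- sgn ∣ A ∣) + Σ     ≡⟨ cong (_+ Σ) (∑⊆-neg M (λ A → sgn ∣ A ∣)) ⟩
  - Σ + Σ                          ≡⟨ ℚP.+-inverseˡ Σ ⟩
  0ℚ                               ∎
  where
  open ≡-Reasoning
  Σ = ∑[ A ⊆ M ] sgn ∣ A ∣
∑⊆-sgn (false ∷ M) = ∑⊆-sgn M

∑⊆-sgn-card : ∀ {n} (M : Subset n) → ∑[ A ⊆ M ] (sgn ∣ A ∣ * nat ∣ A ∣) ≡ - 𝟙 (∣ M ∣ ℕ.≟ 1)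
∑⊆-sgn-card []          = refl
∑⊆-sgn-card (true ∷ M)  = begin
  ∑[ A ⊆ M ] (sgn (suc ∣ A ∣) * nat (suc ∣ A ∣)) + X         ≡⟨ cong (_+ X) (∑⊆-cong M (λ A _ → step ∣ A ∣)) ⟩
  ∑[ A ⊆ M ] (- (sgn ∣ A ∣ + sgn ∣ A ∣ * nat ∣ A ∣)) + X     ≡⟨ cong (_+ X) (∑⊆-neg M (λ A → sgn ∣ A ∣ + sgn ∣ A ∣ * nat ∣ A ∣)) ⟩
  - ∑[ A ⊆ M ] (sgn ∣ A ∣ + sgn ∣ A ∣ * nat ∣ A ∣) + X       ≡⟨ cong (λ z → - z + X) (∑⊆-+ M (λ A → sgn ∣ A ∣) (λ A → sgn ∣ A ∣ * nat ∣ A ∣)) ⟩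
  - (∑[ A ⊆ M ] sgn ∣ A ∣ + X) + X                           ≡⟨ cong (λ z → - (z + X) + X) (∑⊆-sgn M) ⟩
  - (𝟙 (∣ M ∣ ℕ.≟ 0) + X) + X                                ≡⟨ solve 2 (λ z x → :- (z :+ x) :+ x := :- z) refl (𝟙 (∣ M ∣ ℕ.≟ 0)) X ⟩
  - 𝟙 (∣ M ∣ ℕ.≟ 0)                                          ∎
  where
  open ≡-Reasoning
  X = ∑[ A ⊆ M ] (sgn ∣ A ∣ * nat ∣ A ∣)
  step : ∀ k → sgn (suc k) * nat (suc k) ≡ - (sgn k + sgn k * nat k)
  step k = trans (cong₂ _*_ (sgn-suc k) (nat-suc k))
                 (solve 2 (λ s m → :- s :* (con 1ℚ :+ m) := :- (s :+ s :* m)) refl (sgn k) (nat k))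
∑⊆-sgn-card (false ∷ M) = ∑⊆-sgn-card M

∑⊆-sgn-pred : ∀ {n} (M : Subset n) →
              ∑[ A ⊆ M ] (sgn ∣ A ∣ * nat (∣ A ∣ ∸ 1)) ≡ 1ℚ - (𝟙 (∣ M ∣ ℕ.≟ 0) + 𝟙 (∣ M ∣ ℕ.≟ 1))
∑⊆-sgn-pred []          = refl
∑⊆-sgn-pred (true ∷ M)  = begin
  ∑[ A ⊆ M ] (sgn (suc ∣ A ∣) * nat ∣ A ∣) + ∑[ A ⊆ M ] (sgn ∣ A ∣ * nat (∣ A ∣ ∸ 1))
    ≡⟨ cong₂ _+_ (∑⊆-cong M (λ A _ → trans (cong (_* nat ∣ A ∣) (sgn-suc ∣ A ∣)) (sym (ℚP.neg-distribˡ-* (sgn ∣ A ∣) (nat ∣ A ∣))))) (∑⊆-sgn-pred M) ⟩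
  ∑[ A ⊆ M ] (- (sgn ∣ A ∣ * nat ∣ A ∣)) + (1ℚ - (𝟙 (∣ M ∣ ℕ.≟ 0) + 𝟙 (∣ M ∣ ℕ.≟ 1)))
    ≡⟨ cong (_+ (1ℚ - (𝟙 (∣ M ∣ ℕ.≟ 0) + 𝟙 (∣ M ∣ ℕ.≟ 1)))) (trans (∑⊆-neg M (λ A → sgn ∣ A ∣ * nat ∣ A ∣)) (cong -_ (∑⊆-sgn-card M))) ⟩
  - - 𝟙 (∣ M ∣ ℕ.≟ 1) + (1ℚ - (𝟙 (∣ M ∣ ℕ.≟ 0) + 𝟙 (∣ M ∣ ℕ.≟ 1)))
    ≡⟨ solve 2 (λ z o → :- (:- o) :+ (con 1ℚ :- (z :+ o)) := con 1ℚ :- (con 0ℚ :+ z)) refl (𝟙 (∣ M ∣ ℕ.≟ 0)) (𝟙 (∣ M ∣ ℕ.≟ 1)) ⟩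
  1ℚ - (0ℚ + 𝟙 (∣ M ∣ ℕ.≟ 0))
    ∎
  where open ≡-Reasoning
∑⊆-sgn-pred (false ∷ M) = ∑⊆-sgn-pred M

∑⊆-empty : ∀ {n} (M : Subset n) → ∑[ A ⊆ M ] 𝟙 (∣ A ∣ ℕ.≟ 0) ≡ 1ℚ
∑⊆-empty []          = refl
∑⊆-empty (true ∷ M)  = trans (cong₂ _+_ (∑⊆-zero M (λ _ → refl)) (∑⊆-empty M)) (ℚP.+-identityˡ 1ℚ)
∑⊆-empty (false ∷ M) = ∑⊆-empty M

∑⊆-singletons : ∀ {n} (M : Subset n) → ∑[ A ⊆ M ] 𝟙 (∣ A ∣ ℕ.≟ 1) ≡ nat ∣ M ∣
∑⊆-singletons []          = refl
∑⊆-singletons (true ∷ M)  = trans (cong₂ _+_ (∑⊆-empty M) (∑⊆-singletons M)) (sym (nat-suc ∣ M ∣))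
∑⊆-singletons (false ∷ M) = ∑⊆-singletons M

∑⊆-sgn-nonempty : ∀ {n} (M : Subset n) → ∑[ A ⊆ M ] (sgn ∣ A ∣ - 𝟙 (∣ A ∣ ℕ.≟ 0)) ≡ 𝟙 (∣ M ∣ ℕ.≟ 0) - 1ℚ
∑⊆-sgn-nonempty M = begin
  ∑[ A ⊆ M ] (sgn ∣ A ∣ - 𝟙 (∣ A ∣ ℕ.≟ 0))                 ≡⟨ ∑⊆-+ M (λ A → sgn ∣ A ∣) (λ A → - 𝟙 (∣ A ∣ ℕ.≟ 0)) ⟩
  ∑[ A ⊆ M ] sgn ∣ A ∣ + ∑[ A ⊆ M ] (- 𝟙 (∣ A ∣ ℕ.≟ 0))    ≡⟨ cong (∑[ A ⊆ M ] sgn ∣ A ∣ +_) (∑⊆-neg M (λ A → 𝟙 (∣ A ∣ ℕ.≟ 0))) ⟩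
  ∑[ A ⊆ M ] sgn ∣ A ∣ - ∑[ A ⊆ M ] 𝟙 (∣ A ∣ ℕ.≟ 0)        ≡⟨ cong₂ _-_ (∑⊆-sgn M) (∑⊆-empty M) ⟩
  𝟙 (∣ M ∣ ℕ.≟ 0) - 1ℚ                                     ∎
  where open ≡-Reasoning

∑⊆-sgn-≥2 : ∀ {n} (M : Subset n) →
            ∑[ A ⊆ M ] (𝟙 (2 ℕ.≤? ∣ A ∣) * sgn ∣ A ∣) ≡ (𝟙 (∣ M ∣ ℕ.≟ 0) - 1ℚ) + nat ∣ M ∣
∑⊆-sgn-≥2 M = begin
  ∑[ A ⊆ M ] (𝟙 (2 ℕ.≤? ∣ A ∣) * sgn ∣ A ∣)
    ≡⟨ ∑⊆-cong M (λ A _ → split ∣ A ∣) ⟩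
  ∑[ A ⊆ M ] ((sgn ∣ A ∣ - 𝟙 (∣ A ∣ ℕ.≟ 0)) + 𝟙 (∣ A ∣ ℕ.≟ 1))
    ≡⟨ ∑⊆-+ M (λ A → sgn ∣ A ∣ - 𝟙 (∣ A ∣ ℕ.≟ 0)) (λ A → 𝟙 (∣ A ∣ ℕ.≟ 1)) ⟩
  ∑[ A ⊆ M ] (sgn ∣ A ∣ - 𝟙 (∣ A ∣ ℕ.≟ 0)) + ∑[ A ⊆ M ] 𝟙 (∣ A ∣ ℕ.≟ 1)
    ≡⟨ cong₂ _+_ (∑⊆-sgn-nonempty M) (∑⊆-singletons M) ⟩
  (𝟙 (∣ M ∣ ℕ.≟ 0) - 1ℚ) + nat ∣ M ∣
    ∎
  where
  open ≡-Reasoning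
  split : ∀ k → 𝟙 (2 ℕ.≤? k) * sgn k ≡ (sgn k - 𝟙 (k ℕ.≟ 0)) + 𝟙 (k ℕ.≟ 1)
  split zero          = refl
  split (suc zero)    = refl
  split (suc (suc k)) = solve 1 (λ s → con 1ℚ :* s := (s :- con 0ℚ) :+ con 0ℚ) refl (sgn k)

sub?-∪ : ∀ {n} (A B N : Subset n) → sub? (A ∪ B) N ≡ sub? A N ∧ sub? B N
sub?-∪ A B N = does-⇔ (mk⇔ to from) (A ∪ B ⊆? N) ((A ⊆? N) ×-dec (B ⊆? N))
  where
  to : A ∪ B ⊆ N → A ⊆ N × B ⊆ N
  to A∪B⊆N = (λ x∈A → A∪B⊆N (x∈p∪q⁺ (inj₁ x∈A))) , (λ x∈B → A∪B⊆N (x∈p∪q⁺ (inj₂ x∈B)))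
  from : A ⊆ N × B ⊆ N → A ∪ B ⊆ N
  from (A⊆N , B⊆N) x∈A∪B = [ A⊆N , B⊆N ] (x∈p∪q⁻ A B x∈A∪B)

sub?-⁅⁆ : ∀ {n} (u : Fin n) N → sub? ⁅ u ⁆ N ≡ does (u ∈? N)
sub?-⁅⁆ u N = does-⇔ (mk⇔ to from) (⁅ u ⁆ ⊆? N) (u ∈? N)
  where
  to : ⁅ u ⁆ ⊆ N → u ∈ N
  to ⁅u⁆⊆N = ⁅u⁆⊆N (x∈⁅x⁆ u)
  from : u ∈ N → ⁅ u ⁆ ⊆ N
  from u∈N x∈⁅u⁆ = subst (_∈ N) (sym (x∈⁅y⁆⇒x≡y u x∈⁅u⁆)) u∈N

2≤∣A∪⁅u⁆∣ : ∀ {n} {A : Subset n} {u} → A ⊆ ∁ ⁅ u ⁆ → 1 ≤ ∣ A ∣ → 2 ≤ ∣ A ∪ ⁅ u ⁆ ∣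
2≤∣A∪⁅u⁆∣ {A = A} {u} A⊆∁⁅u⁆ 1≤∣A∣ = ℕP.<-≤-trans (s≤s 1≤∣A∣) (p⊂q⇒∣p∣<∣q∣ A⊂A∪⁅u⁆)
  where
  A⊂A∪⁅u⁆ : A ⊂ A ∪ ⁅ u ⁆
  A⊂A∪⁅u⁆ = (λ {x} → p⊆p∪q ⁅ u ⁆ {x}) , u , x∈p∪q⁺ (inj₂ (x∈⁅x⁆ u)) , λ u∈A → x∈∁p⇒x∉p (A⊆∁⁅u⁆ u∈A) (x∈⁅x⁆ u)

∣p∩q∣+∣∁p∩q∣ : ∀ {n} (p q : Subset n) → ∣ p ∩ q ∣ ℕ.+ ∣ ∁ p ∩ q ∣ ≡ ∣ q ∣
∣p∩q∣+∣∁p∩q∣ []          []          = refl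
∣p∩q∣+∣∁p∩q∣ (true ∷ p)  (true ∷ q)  = cong suc (∣p∩q∣+∣∁p∩q∣ p q)
∣p∩q∣+∣∁p∩q∣ (true ∷ p)  (false ∷ q) = ∣p∩q∣+∣∁p∩q∣ p q
∣p∩q∣+∣∁p∩q∣ (false ∷ p) (true ∷ q)  = trans (ℕP.+-suc ∣ p ∩ q ∣ _) (cong suc (∣p∩q∣+∣∁p∩q∣ p q))
∣p∩q∣+∣∁p∩q∣ (false ∷ p) (false ∷ q) = ∣p∩q∣+∣∁p∩q∣ p q

2≰0 : ¬ (2 ≤ 0)
2≰0 ()

2≰1 : ¬ (2 ≤ 1)
2≰1 (s≤s ())

x∈p⇒∣p∣≢0 : ∀ {n} {x} {p : Subset n} → x ∈ p → ∣ p ∣ ≢ 0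
x∈p⇒∣p∣≢0 {x = x} {p} x∈p ∣p∣≡0 = ℕP.n≮0 (subst (∣ p ∖ x ∣ <_) ∣p∣≡0 (x∈p⇒∣p-x∣<∣p∣ x∈p))

members : ∀ {n} → Subset n → List (Fin n)
members {n} I = filter (_∈? I) (allFin n)

sumList-members : ∀ {n} (I : Subset n) f → sumList f (members I) ≡ sumFin (λ u → 𝟙 (u ∈? I) * f u)
sumList-members {n} I f = trans (sumList-filter (_∈? I) f (allFin n)) (sumList-tabulate (λ u → 𝟙 (u ∈? I) * f u) (λ u → u))

sumFin-∈ : ∀ {n} (M : Subset n) → sumFin (λ u → 𝟙 (u ∈? M)) ≡ nat ∣ M ∣
sumFin-∈ []          = refl
sumFin-∈ (true ∷ M)  = trans (cong (1ℚ +_) (sumFin-∈ M)) (sym (nat-suc ∣ M ∣))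
sumFin-∈ (false ∷ M) = trans (ℚP.+-identityˡ _) (sumFin-∈ M)

∈?-∩ : ∀ {n} u (I N : Subset n) → does (u ∈? (I ∩ N)) ≡ does (u ∈? I) ∧ does (u ∈? N)
∈?-∩ u I N = does-⇔ ∩⇔× (u ∈? (I ∩ N)) ((u ∈? I) ×-dec (u ∈? N))

count-members : ∀ {n} (I : Subset n) → sumList (λ _ → 1ℚ) (members I) ≡ nat ∣ I ∣
count-members I = trans (sumList-members I (λ _ → 1ℚ))
  (trans (sumFin-cong (λ u → ℚP.*-identityʳ (𝟙 (u ∈? I)))) (sumFin-∈ I))

count-members-∈ : ∀ {n} (I N : Subset n) → sumList (λ u → 𝟙 (u ∈? N)) (members I) ≡ nat ∣ I ∩ N ∣
count-members-∈ I N = trans (sumList-members I (λ u → 𝟙 (u ∈? N)))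
  (trans (sumFin-cong (λ u → trans (sym (b2q-∧ (does (u ∈? I)) _)) (cong b2q (sym (∈?-∩ u I N)))))
         (sumFin-∈ (I ∩ N)))

-- The vertices of CIM_S^I

parents : ∀ {n} → Orientation n → Subset n
parents o = Vec.tabulate (not ∘ o)

withParents : ∀ {n} → Subset n → Orientation n
withParents P u = not (does (u ∈? P))

parents-withParents : ∀ {n} (P : Subset n) → parents (withParents P) ≡ P
parents-withParents []          = refl
parents-withParents (true ∷ P)  = cong (true ∷_) (parents-withParents P)
parents-withParents (false ∷ P) = cong (false ∷_) (parents-withParents P)

∈-parents : ∀ {n} {o : Orientation n} {u} → u ∈ parents o ⇔ T (not (o u))
∈-parents {o = o} {u} = mk⇔
  (λ u∈N → Equivalence.from T-≡ (trans (sym (lookup∘tabulate (not ∘ o) u)) ([]=⇒lookup u∈N)))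
  (λ t → lookup⇒[]= u (parents o) (trans (lookup∘tabulate (not ∘ o) u) (Equivalence.to T-≡ t)))

T-all-leaves : ∀ {n} (p : Node n → Bool) (U : Subset n) →
               T (all p (leavesOf U)) ⇔ (∀ {u} → u ∈ U → T (p (leaf u)))
T-all-leaves {n} p U = mk⇔ to from
  where
  to : T (all p (leavesOf U)) → ∀ {u} → u ∈ U → T (p (leaf u))
  to t u∈U = All.lookup (Allₚ.map⁻ (Allₚ.all⁺ p _ t)) (∈-filter⁺ (_∈? U) (∈-allFin _) u∈U)
  from : (∀ {u} → u ∈ U → T (p (leaf u))) → T (all p (leavesOf U))
  from h = Allₚ.all⁻ p (Allₚ.map⁺ (All.tabulate λ {u} u∈ → h (proj₂ (∈-filter⁻ (_∈? U) {u} {allFin n} u∈))))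

T-any-leaves : ∀ {n} (p : Node n → Bool) (U : Subset n) →
               T (any p (leavesOf U)) → ∃[ u ] (u ∈ U × T (p (leaf u)))
T-any-leaves {n} p U t with find (Anyₚ.map⁻ (Anyₚ.any⁻ p (leavesOf U) t))
... | u , u∈ , pu = u , proj₂ (∈-filter⁻ (_∈? U) {u} {allFin n} u∈) , pu

charImset-leaves : ∀ {n} (o : Orientation n) I (U : Subset n) → 2 ≤ ∣ U ∣ →
                   charImset o I (center ∷ leavesOf U) ≡ sub? U (parents o)
charImset-leaves o I U 2≤∣U∣ = does-⇔ (mk⇔ to from) (T? _) (U ⊆? parents o)
  where
  -- A leaf w can only be the sink of {c} ∪ U if every other node is a parent of w,
  -- but its only neighbour is c; this forces U ⊆ ⁅ w ⁆.
  no-leaf-is-sink : ¬ T (any (λ a → all (λ b → eqNode b a ∨ arrow o I b a) (center ∷ leavesOf U)) (leavesOf U))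
  no-leaf-is-sink t with T-any-leaves _ U t
  ... | w , _ , tw = ℕP.<⇒≱ 2≤∣U∣ (subst (∣ U ∣ ≤_) (∣⁅x⁆∣≡1 w) (p⊆q⇒∣p∣≤∣q∣ U⊆⁅w⁆))
    where
    U⊆⁅w⁆ : U ⊆ ⁅ w ⁆
    U⊆⁅w⁆ {v} v∈U = v≡w (v Fin.≟ w) (Equivalence.to (T-all-leaves _ U) (proj₂ (Equivalence.to T-∧ tw)) v∈U)
      where
      v≡w : (v≟w : Dec (v ≡ w)) → T (does v≟w ∨ false) → v ∈ ⁅ w ⁆
      v≡w (yes refl) _ = x∈⁅x⁆ v
      v≡w (no _)     ()
  to : T (charImset o I (center ∷ leavesOf U)) → U ⊆ parents o
  to t with Equivalence.to T-∨ t
  ... | inj₁ t-centre = λ u∈U → Equivalence.from ∈-parents (Equivalence.to (T-all-leaves _ U) t-centre u∈U)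
  ... | inj₂ t-leaf   = ⊥-elim (no-leaf-is-sink t-leaf)
  from : U ⊆ parents o → T (charImset o I (center ∷ leavesOf U))
  from U⊆N = Equivalence.from T-∨
    (inj₁ (Equivalence.from (T-all-leaves _ U) (λ u∈U → Equivalence.to ∈-parents (U⊆N u∈U))))

xS-vertex : ∀ {n} (I : Subset n) o U → 2 ≤ ∣ U ∣ → xS (cimVertex I o) U ≡ b2q (sub? U (parents o))
xS-vertex I o U 2≤∣U∣ with 2 ℕ.≤? ∣ U ∣
... | yes _   = cong b2q (charImset-leaves o I U 2≤∣U∣)
... | no 2≰∣U∣ = ⊥-elim (2≰∣U∣ 2≤∣U∣)

charImset-bidirected : ∀ {n} (o : Orientation n) I {u} → u ∈ I →
                       charImset o I (center ∷ leaf u ∷ prime u ∷ []) ≡ o u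
charImset-bidirected o I {u} u∈I with o u | u Fin.≟ u | u ∈? I
... | true  | yes _   | yes _  = refl
... | false | yes _   | yes _  = refl
... | _     | no u≢u  | _      = ⊥-elim (u≢u refl)
... | _     | _       | no u∉I = ⊥-elim (u∉I u∈I)

xB-vertex : ∀ {n} (I : Subset n) o {u} → u ∈ I → xB (cimVertex I o) u ≡ 1ℚ - 𝟙 (u ∈? parents o)
xB-vertex I o {u} u∈I with u ∈? I
... | yes _   = trans (cong b2q (charImset-bidirected o I u∈I))
                      (trans (b2q-complement (o u)) (cong (λ b → 1ℚ - b2q b) (sym (does-⇔ ∈-parents (u ∈? parents o) (T? (not (o u)))))))
... | no u∉I = ⊥-elim (u∉I u∈I)

-- The inequalities as affine functionals

slackConst : ∀ {n} → Subset n → Ineq n → ℚ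
slackConst I (star T)  = 0ℚ
slackConst I (bidir u) = 1ℚ
slackConst I forked    = 1ℚ - nat ∣ I ∣

slackLinear : ∀ {n} (I : Subset n) → Ineq n → Point n I → ℚ
slackLinear I (star T)  x = starLHS T x
slackLinear I (bidir u) x = - bidirLHS u x
slackLinear I forked    x = (hashI I x - oneCI I x) + sumList (xB x) (members I)

slack : ∀ {n} (I : Subset n) → Ineq n → Point n I → ℚ
slack I g x = slackConst I g + slackLinear I g x

holds⇔slack-nonneg : ∀ {n} (I : Subset n) g x → HoldsIneq I g x ⇔ 0ℚ ℚ.≤ slack I g x
holds⇔slack-nonneg I (star T)  x = mk⇔ (subst (0ℚ ℚ.≤_) (sym (ℚP.+-identityˡ _)))
                                        (subst (0ℚ ℚ.≤_) (ℚP.+-identityˡ _))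
holds⇔slack-nonneg I (bidir u) x = p≤q⇔0≤q-p
holds⇔slack-nonneg I forked    x = mk⇔ (subst (0ℚ ℚ.≤_) slack≡ ∘ Equivalence.to p≤q⇔0≤q-p)
                                        (Equivalence.from p≤q⇔0≤q-p ∘ subst (0ℚ ℚ.≤_) (sym slack≡))
  where
  open ≡-Reasoning
  Σ1 = sumList (λ _ → 1ℚ) (members I)
  ΣxB = sumList (xB x) (members I)
  slack≡ : (1ℚ + hashI I x) - forkedLHS I x ≡ slack I forked x
  slack≡ = begin
    (1ℚ + hashI I x) - (oneCI I x + sumList (λ u → 1ℚ + - xB x u) (members I))
      ≡⟨ cong (λ z → (1ℚ + hashI I x) - (oneCI I x + z)) (sumList-+ (λ _ → 1ℚ) (λ u → - xB x u) (members I)) ⟩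
    (1ℚ + hashI I x) - (oneCI I x + (Σ1 + sumList (λ u → - xB x u) (members I)))
      ≡⟨ cong (λ z → (1ℚ + hashI I x) - (oneCI I x + (Σ1 + z))) (sumList-neg (xB x) (members I)) ⟩
    (1ℚ + hashI I x) - (oneCI I x + (Σ1 + - ΣxB))
      ≡⟨ solve 4 (λ h o s b → (con 1ℚ :+ h) :- (o :+ (s :+ :- b)) := (con 1ℚ :- s) :+ ((h :- o) :+ b)) refl (hashI I x) (oneCI I x) Σ1 ΣxB ⟩
    (1ℚ - Σ1) + ((hashI I x - oneCI I x) + ΣxB)
      ≡⟨ cong (λ z → (1ℚ - z) + ((hashI I x - oneCI I x) + ΣxB)) (count-members I) ⟩
    slack I forked x
      ∎

xS-linear : ∀ {n} {I : Subset n} U → Linear (λ (x : Point n I) → xS x U)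
xS-linear {n} {I} U with 2 ℕ.≤? ∣ U ∣
... | yes 2≤∣U∣ = Linear-at {Coord n I} (inj₁ (U , 2≤∣U∣))
... | no _      = Linear-zero {Coord n I}

xB-linear : ∀ {n} {I : Subset n} u → Linear (λ (x : Point n I) → xB x u)
xB-linear {n} {I} u with u ∈? I
... | yes u∈I = Linear-at {Coord n I} (inj₂ (u , u∈I))
... | no _    = Linear-zero {Coord n I}

Linear-sumSub : ∀ {n} {I : Subset n} P (L : Subset n → Point n I → ℚ) →
                (∀ U → Linear (L U)) → Linear (λ x → sumSub P (λ U → L U x))
Linear-sumSub {n} P L = Linear-sumList L (filterᵇ P (allSubsets n))

slackLinear-linear : ∀ {n} (I : Subset n) g → Linear (slackLinear I g)
slackLinear-linear I (star T)  =
  Linear-sumSub (sub? T) _ (λ U → Linear-*ˡ (sgn (∣ U ∣ ∸ ∣ T ∣)) (xS-linear U))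
slackLinear-linear I (bidir u) = Linear-neg (Linear-+ (xB-linear u)
  (Linear-sumSub _ _ (λ A → Linear-*ˡ (sgn (suc ∣ A ∣)) (xS-linear (A ∪ ⁅ u ⁆)))))
slackLinear-linear I forked    = Linear-+ (Linear-+ hashI-linear (Linear-neg oneCI-linear))
                                          (Linear-sumList (λ u x → xB x u) (members I) xB-linear)
  where
  hashI-linear : Linear (hashI I)
  hashI-linear = Linear-sumSub _ _ (λ T → Linear-*ˡ (sgn ∣ T ∣) (xS-linear T))
  oneCI-linear : Linear (oneCI I)
  oneCI-linear = Linear-sumSub _ _ λ T → Linear-sumSub _ _ λ B →
    Linear-*ˡ (sgn (∣ T ∣ ℕ.+ ∣ B ∣)) (Linear-*ˡ (nat (∣ T ∣ ∸ 1)) (xS-linear (T ∪ B)))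

xS-at : ∀ {n} {I : Subset n} (x : Point n I) U (2≤∣U∣ : 2 ≤ ∣ U ∣) → xS x U ≡ x (inj₁ (U , 2≤∣U∣))
xS-at x U 2≤∣U∣ with 2 ℕ.≤? ∣ U ∣
... | yes p    = cong (λ q → x (inj₁ (U , q))) (ℕP.≤-irrelevant p 2≤∣U∣)
... | no 2≰∣U∣ = ⊥-elim (2≰∣U∣ 2≤∣U∣)

xS-small : ∀ {n} {I : Subset n} (x : Point n I) U → ¬ (2 ≤ ∣ U ∣) → xS x U ≡ 0ℚ
xS-small x U 2≰∣U∣ with 2 ℕ.≤? ∣ U ∣
... | yes 2≤∣U∣ = ⊥-elim (2≰∣U∣ 2≤∣U∣)
... | no _      = refl

xB-at : ∀ {n} {I : Subset n} (x : Point n I) u (u∈I : u ∈ I) → xB x u ≡ x (inj₂ (u , u∈I))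
xB-at {I = I} x u u∈I with u ∈? I
... | yes p   = cong (λ q → x (inj₂ (u , q))) ([]=-irrelevant p u∈I)
... | no u∉I = ⊥-elim (u∉I u∈I)

stars-determine-xS : ∀ {n} {I : Subset n} (d : Point n I) →
                     (∀ T → 2 ≤ ∣ T ∣ → starLHS T d ≡ 0ℚ) → ∀ U → xS d U ≡ 0ℚ
stars-determine-xS d star≡0 = möbius-injective 2 (xS d) (λ U ∣U∣<2 → xS-small d U (ℕP.<⇒≱ ∣U∣<2))
  (λ T 2≤∣T∣ → trans (sym (sumSub-⊇ T (λ U → sgn (∣ U ∣ ∸ ∣ T ∣) * xS d U))) (star≡0 T 2≤∣T∣))

bidirLHS-on-xS≡0 : ∀ {n} {I : Subset n} (d : Point n I) u → (∀ U → xS d U ≡ 0ℚ) → bidirLHS u d ≡ xB d u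
bidirLHS-on-xS≡0 {n} d u xS≡0 = trans (cong (xB d u +_) Σ≡0) (ℚP.+-identityʳ (xB d u))
  where
  Σ≡0 = sumList-zero (filterᵇ (λ A → sub? A (∁ ⁅ u ⁆) ∧ not (does (∣ A ∣ ℕ.≟ 0))) (allSubsets n)) λ A →
    trans (cong (sgn (suc ∣ A ∣) *_) (xS≡0 (A ∪ ⁅ u ⁆))) (ℚP.*-zeroʳ (sgn (suc ∣ A ∣)))

forkedLinear-on-xS≡0 : ∀ {n} (I : Subset n) (d : Point n I) → (∀ U → xS d U ≡ 0ℚ) →
                       slackLinear I forked d ≡ sumList (xB d) (members I)
forkedLinear-on-xS≡0 {n} I d xS≡0 =
  trans (cong₂ (λ h o → (h - o) + sumList (xB d) (members I)) hashI≡0 oneCI≡0) (ℚP.+-identityˡ _)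
  where
  hashI≡0 : hashI I d ≡ 0ℚ
  hashI≡0 = sumList-zero (filterᵇ (λ T → sub? T I ∧ does (2 ℕ.≤? ∣ T ∣)) (allSubsets n)) λ T →
    trans (cong (sgn ∣ T ∣ *_) (xS≡0 T)) (ℚP.*-zeroʳ (sgn ∣ T ∣))
  oneCI≡0 : oneCI I d ≡ 0ℚ
  oneCI≡0 = sumList-zero (filterᵇ (λ T → sub? T (∁ I) ∧ does (2 ℕ.≤? ∣ T ∣)) (allSubsets n)) λ T →
            sumList-zero (filterᵇ (λ B → sub? B I) (allSubsets n)) λ B →
    trans (cong (λ x → sgn (∣ T ∣ ℕ.+ ∣ B ∣) * (nat (∣ T ∣ ∸ 1) * x)) (xS≡0 (T ∪ B)))
          (solve 2 (λ σ m → σ :* (m :* con 0ℚ) := con 0ℚ) refl (sgn (∣ T ∣ ℕ.+ ∣ B ∣)) (nat (∣ T ∣ ∸ 1)))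

slackLinear-injective : ∀ {n} (I : Subset n) (d : Point n I) t →
  (∀ g → ValidIneq I g → slackLinear I g d ≡ slackConst I g * t) → t ≡ 0ℚ × (∀ κ → d κ ≡ 0ℚ)
slackLinear-injective {n} I d t L≡ct = t≡0 , d≡0
  where
  open ≡-Reasoning
  xS≡0 : ∀ U → xS d U ≡ 0ℚ
  xS≡0 = stars-determine-xS d (λ T 2≤∣T∣ → trans (L≡ct (star T) 2≤∣T∣) (ℚP.*-zeroˡ t))
  xB≡-t : ∀ {u} → u ∈ I → xB d u ≡ - t
  xB≡-t {u} u∈I = begin
    xB d u             ≡⟨ bidirLHS-on-xS≡0 d u xS≡0 ⟨
    bidirLHS u d       ≡⟨ neg-involutive (bidirLHS u d) ⟨
    - - bidirLHS u d   ≡⟨ cong -_ (trans (L≡ct (bidir u) u∈I) (ℚP.*-identityˡ t)) ⟩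
    - t                ∎
  a = nat ∣ I ∣
  ΣxB≡ : sumList (xB d) (members I) ≡ (- t) * a
  ΣxB≡ = begin
    sumList (xB d) (members I)
      ≡⟨ sumList-cong (members I) (λ u∈ → trans (xB≡-t (proj₂ (∈-filter⁻ (_∈? I) {xs = allFin n} u∈)))
                                                (sym (ℚP.*-identityʳ (- t)))) ⟩
    sumList (λ _ → (- t) * 1ℚ) (members I)  ≡⟨ sumList-*ˡ (- t) (λ _ → 1ℚ) (members I) ⟩
    (- t) * sumList (λ _ → 1ℚ) (members I)  ≡⟨ cong ((- t) *_) (count-members I) ⟩
    (- t) * a                               ∎
  t≡0 : t ≡ 0ℚ
  t≡0 = begin
    t                                ≡⟨ solve 2 (λ t a → t := (con 1ℚ :- a) :* t :- (:- t) :* a) refl t a ⟩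
    (1ℚ - a) * t - (- t) * a         ≡⟨ cong (λ z → (1ℚ - a) * t - z) (begin
      (- t) * a                            ≡⟨ ΣxB≡ ⟨
      sumList (xB d) (members I)           ≡⟨ forkedLinear-on-xS≡0 I d xS≡0 ⟨
      slackLinear I forked d               ≡⟨ L≡ct forked tt ⟩
      (1ℚ - a) * t                         ∎) ⟩
    (1ℚ - a) * t - (1ℚ - a) * t      ≡⟨ ℚP.+-inverseʳ ((1ℚ - a) * t) ⟩
    0ℚ                               ∎
  d≡0 : ∀ κ → d κ ≡ 0ℚ
  d≡0 (inj₁ (U , 2≤∣U∣)) = trans (sym (xS-at d U 2≤∣U∣)) (xS≡0 U)
  d≡0 (inj₂ (u , u∈I))   = trans (sym (xB-at d u u∈I)) (trans (xB≡-t u∈I) (cong -_ t≡0))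

-- [N ≡ T], [N ≡ ⁅ u ⁆] and [N ∩ I ≡ ⊥ and ∣ N ∣ ≤ 1], in the form the computation produces.
vertexSlack : ∀ {n} → Subset n → Ineq n → Subset n → ℚ
vertexSlack I (star T)  N = 𝟙 (T ≟ₛ N)
vertexSlack I (bidir u) N = 𝟙 (u ∈? N) * 𝟙 (∣ ∁ ⁅ u ⁆ ∩ N ∣ ℕ.≟ 0)
vertexSlack I forked    N = 𝟙 (∣ I ∩ N ∣ ℕ.≟ 0) * (𝟙 (∣ ∁ I ∩ N ∣ ℕ.≟ 0) + 𝟙 (∣ ∁ I ∩ N ∣ ℕ.≟ 1))

vertexSlack-nonneg : ∀ {n} (I : Subset n) g N → 0ℚ ℚ.≤ vertexSlack I g N
vertexSlack-nonneg I (star T)  N = b2q-nonneg (does (T ≟ₛ N))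
vertexSlack-nonneg I (bidir u) N = nonneg-* (b2q-nonneg (does (u ∈? N))) (b2q-nonneg (does (∣ ∁ ⁅ u ⁆ ∩ N ∣ ℕ.≟ 0)))
vertexSlack-nonneg I forked    N = nonneg-* (b2q-nonneg (does (∣ I ∩ N ∣ ℕ.≟ 0)))
  (ℚP.+-mono-≤ (b2q-nonneg (does (∣ ∁ I ∩ N ∣ ℕ.≟ 0))) (b2q-nonneg (does (∣ ∁ I ∩ N ∣ ℕ.≟ 1))))

module _ {n} (I : Subset n) (o : Orientation n) where

  private
    v = cimVertex I o
    N = parents o

  starLHS-vertex : ∀ T → 2 ≤ ∣ T ∣ → starLHS T v ≡ 𝟙 (T ≟ₛ N)
  starLHS-vertex T 2≤∣T∣ = begin
    starLHS T v                        ≡⟨ sumSub-⊇ T (λ U → sgn (∣ U ∣ ∸ ∣ T ∣) * xS v U) ⟩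
    möbius (xS v) T                    ≡⟨ ∑⊇-cong T (λ U T⊆U → cong (sgn (∣ U ∣ ∸ ∣ T ∣) *_) (xS-vertex I o U (ℕP.≤-trans 2≤∣T∣ (p⊆q⇒∣p∣≤∣q∣ T⊆U)))) ⟩
    möbius (λ U → b2q (sub? U N)) T    ≡⟨ möbius-⊆ T N ⟩
    𝟙 (T ≟ₛ N)                         ∎
    where open ≡-Reasoning

  bidirLHS-vertex : ∀ {u} → u ∈ I → bidirLHS u v ≡ 1ℚ - vertexSlack I (bidir u) N
  bidirLHS-vertex {u} u∈I = begin
    xB v u + sumSub (λ A → sub? A M ∧ not (does (∣ A ∣ ℕ.≟ 0))) (λ A → sgn (suc ∣ A ∣) * xS v (A ∪ ⁅ u ⁆))
      ≡⟨ cong₂ _+_ (xB-vertex I o u∈I) (sumSub-⊆∧ M (λ A → not (does (∣ A ∣ ℕ.≟ 0))) (λ A → sgn (suc ∣ A ∣) * xS v (A ∪ ⁅ u ⁆))) ⟩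
    (1ℚ - e) + ∑[ A ⊆ M ] (b2q (not (does (∣ A ∣ ℕ.≟ 0))) * (sgn (suc ∣ A ∣) * xS v (A ∪ ⁅ u ⁆)))
      ≡⟨ cong ((1ℚ - e) +_) (∑⊆-cong M term) ⟩
    (1ℚ - e) + ∑[ A ⊆ M ] (e * (b2q (sub? A N) * - (sgn ∣ A ∣ - 𝟙 (∣ A ∣ ℕ.≟ 0))))
      ≡⟨ cong ((1ℚ - e) +_) (trans (∑⊆-*ˡ M e _) (cong (e *_) (∑⊆-∩ M N (λ A → - (sgn ∣ A ∣ - 𝟙 (∣ A ∣ ℕ.≟ 0)))))) ⟩
    (1ℚ - e) + e * ∑[ A ⊆ M ∩ N ] (- (sgn ∣ A ∣ - 𝟙 (∣ A ∣ ℕ.≟ 0)))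
      ≡⟨ cong (λ z → (1ℚ - e) + e * z) (trans (∑⊆-neg (M ∩ N) (λ A → sgn ∣ A ∣ - 𝟙 (∣ A ∣ ℕ.≟ 0))) (cong -_ (∑⊆-sgn-nonempty (M ∩ N)))) ⟩
    (1ℚ - e) + e * - (Z - 1ℚ)
      ≡⟨ solve 2 (λ e z → (con 1ℚ :- e) :+ e :* (:- (z :- con 1ℚ)) := con 1ℚ :- e :* z) refl e Z ⟩
    1ℚ - e * Z
      ∎
    where
    open ≡-Reasoning
    M = ∁ ⁅ u ⁆
    e = 𝟙 (u ∈? N)
    Z = 𝟙 (∣ M ∩ N ∣ ℕ.≟ 0)
    term : ∀ A → A ⊆ M → b2q (not (does (∣ A ∣ ℕ.≟ 0))) * (sgn (suc ∣ A ∣) * xS v (A ∪ ⁅ u ⁆))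
                       ≡ e * (b2q (sub? A N) * - (sgn ∣ A ∣ - 𝟙 (∣ A ∣ ℕ.≟ 0)))
    term A A⊆M with ∣ A ∣ in ∣A∣≡
    ... | zero  = solve 3 (λ x e s → con 0ℚ :* (con (- 1ℚ) :* x) := e :* (s :* :- (con 1ℚ :- con 1ℚ))) refl
                          (xS v (A ∪ ⁅ u ⁆)) e (b2q (sub? A N))
    ... | suc k = begin
      1ℚ * (sgn k * xS v (A ∪ ⁅ u ⁆))          ≡⟨ cong (λ x → 1ℚ * (sgn k * x)) x≡ ⟩
      1ℚ * (sgn k * (b2q (sub? A N) * e))
        ≡⟨ solve 3 (λ σ s e → con 1ℚ :* (σ :* (s :* e)) := e :* (s :* :- (:- σ :- con 0ℚ))) refl (sgn k) (b2q (sub? A N)) e ⟩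
      e * (b2q (sub? A N) * - (- sgn k - 0ℚ))
        ≡⟨ cong (λ z → e * (b2q (sub? A N) * - (z - 0ℚ))) (sgn-suc k) ⟨
      e * (b2q (sub? A N) * - (sgn (suc k) - 0ℚ))
        ∎
      where
      x≡ : xS v (A ∪ ⁅ u ⁆) ≡ b2q (sub? A N) * e
      x≡ = begin
        xS v (A ∪ ⁅ u ⁆)                         ≡⟨ xS-vertex I o (A ∪ ⁅ u ⁆) (2≤∣A∪⁅u⁆∣ A⊆M (subst (1 ≤_) (sym ∣A∣≡) (s≤s z≤n))) ⟩
        b2q (sub? (A ∪ ⁅ u ⁆) N)                 ≡⟨ cong b2q (trans (sub?-∪ A ⁅ u ⁆ N) (cong (sub? A N ∧_) (sub?-⁅⁆ u N))) ⟩
        b2q (sub? A N ∧ does (u ∈? N))           ≡⟨ b2q-∧ (sub? A N) (does (u ∈? N)) ⟩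
        b2q (sub? A N) * e                       ∎

  hashI-vertex : hashI I v ≡ (𝟙 (∣ I ∩ N ∣ ℕ.≟ 0) - 1ℚ) + nat ∣ I ∩ N ∣
  hashI-vertex = begin
    sumSub (λ T → sub? T I ∧ does (2 ℕ.≤? ∣ T ∣)) (λ T → sgn ∣ T ∣ * xS v T)
      ≡⟨ sumSub-⊆∧ I (λ T → does (2 ℕ.≤? ∣ T ∣)) (λ T → sgn ∣ T ∣ * xS v T) ⟩
    ∑[ T ⊆ I ] (𝟙 (2 ℕ.≤? ∣ T ∣) * (sgn ∣ T ∣ * xS v T))
      ≡⟨ ∑⊆-cong I (λ T _ → term T) ⟩
    ∑[ T ⊆ I ] (b2q (sub? T N) * (𝟙 (2 ℕ.≤? ∣ T ∣) * sgn ∣ T ∣))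
      ≡⟨ ∑⊆-∩ I N (λ T → 𝟙 (2 ℕ.≤? ∣ T ∣) * sgn ∣ T ∣) ⟩
    ∑[ T ⊆ I ∩ N ] (𝟙 (2 ℕ.≤? ∣ T ∣) * sgn ∣ T ∣)
      ≡⟨ ∑⊆-sgn-≥2 (I ∩ N) ⟩
    (𝟙 (∣ I ∩ N ∣ ℕ.≟ 0) - 1ℚ) + nat ∣ I ∩ N ∣
      ∎
    where
    open ≡-Reasoning
    term : ∀ T → 𝟙 (2 ℕ.≤? ∣ T ∣) * (sgn ∣ T ∣ * xS v T) ≡ b2q (sub? T N) * (𝟙 (2 ℕ.≤? ∣ T ∣) * sgn ∣ T ∣)
    term T = trans (𝟙*-cong (2 ℕ.≤? ∣ T ∣) (λ 2≤∣T∣ → cong (sgn ∣ T ∣ *_) (xS-vertex I o T 2≤∣T∣)))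
                   (solve 3 (λ g σ s → g :* (σ :* s) := s :* (g :* σ)) refl (𝟙 (2 ℕ.≤? ∣ T ∣)) (sgn ∣ T ∣) (b2q (sub? T N)))

  oneCI-summand-vertex : ∀ T → 2 ≤ ∣ T ∣ →
    sumSub (λ B → sub? B I) (λ B → sgn (∣ T ∣ ℕ.+ ∣ B ∣) * (nat (∣ T ∣ ∸ 1) * xS v (T ∪ B)))
      ≡ (b2q (sub? T N) * (sgn ∣ T ∣ * nat (∣ T ∣ ∸ 1))) * 𝟙 (∣ I ∩ N ∣ ℕ.≟ 0)
  oneCI-summand-vertex T 2≤∣T∣ = begin
    sumSub (λ B → sub? B I) (λ B → sgn (∣ T ∣ ℕ.+ ∣ B ∣) * (m * xS v (T ∪ B)))
      ≡⟨ sumSub-⊆ I (λ B → sgn (∣ T ∣ ℕ.+ ∣ B ∣) * (m * xS v (T ∪ B))) ⟩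
    ∑[ B ⊆ I ] (sgn (∣ T ∣ ℕ.+ ∣ B ∣) * (m * xS v (T ∪ B)))
      ≡⟨ ∑⊆-cong I (λ B _ → factor B) ⟩
    ∑[ B ⊆ I ] (c * (b2q (sub? B N) * sgn ∣ B ∣))
      ≡⟨ ∑⊆-*ˡ I c (λ B → b2q (sub? B N) * sgn ∣ B ∣) ⟩
    c * ∑[ B ⊆ I ] (b2q (sub? B N) * sgn ∣ B ∣)
      ≡⟨ cong (c *_) (trans (∑⊆-∩ I N (λ B → sgn ∣ B ∣)) (∑⊆-sgn (I ∩ N))) ⟩
    c * 𝟙 (∣ I ∩ N ∣ ℕ.≟ 0)
      ∎
    where
    open ≡-Reasoning
    m = nat (∣ T ∣ ∸ 1)
    c = b2q (sub? T N) * (sgn ∣ T ∣ * m)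
    factor : ∀ B → sgn (∣ T ∣ ℕ.+ ∣ B ∣) * (m * xS v (T ∪ B)) ≡ c * (b2q (sub? B N) * sgn ∣ B ∣)
    factor B = begin
      sgn (∣ T ∣ ℕ.+ ∣ B ∣) * (m * xS v (T ∪ B))
        ≡⟨ cong₂ (λ σ x → σ * (m * x)) (sgn-+ ∣ T ∣ ∣ B ∣)
                 (xS-vertex I o (T ∪ B) (ℕP.≤-trans 2≤∣T∣ (p⊆q⇒∣p∣≤∣q∣ (p⊆p∪q {p = T} B)))) ⟩
      (sgn ∣ T ∣ * sgn ∣ B ∣) * (m * b2q (sub? (T ∪ B) N))
        ≡⟨ cong (λ x → (sgn ∣ T ∣ * sgn ∣ B ∣) * (m * x))
                (trans (cong b2q (sub?-∪ T B N)) (b2q-∧ (sub? T N) (sub? B N))) ⟩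
      (sgn ∣ T ∣ * sgn ∣ B ∣) * (m * (b2q (sub? T N) * b2q (sub? B N)))
        ≡⟨ solve 5 (λ σ τ m s t → (σ :* τ) :* (m :* (s :* t)) := (s :* (σ :* m)) :* (t :* τ)) refl
                   (sgn ∣ T ∣) (sgn ∣ B ∣) m (b2q (sub? T N)) (b2q (sub? B N)) ⟩
      c * (b2q (sub? B N) * sgn ∣ B ∣)
        ∎

  oneCI-vertex : oneCI I v ≡ 𝟙 (∣ I ∩ N ∣ ℕ.≟ 0) * (1ℚ - (𝟙 (∣ ∁ I ∩ N ∣ ℕ.≟ 0) + 𝟙 (∣ ∁ I ∩ N ∣ ℕ.≟ 1)))
  oneCI-vertex = begin
    sumSub (λ T → sub? T (∁ I) ∧ does (2 ℕ.≤? ∣ T ∣)) inner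
      ≡⟨ sumSub-⊆∧ (∁ I) (λ T → does (2 ℕ.≤? ∣ T ∣)) inner ⟩
    ∑[ T ⊆ ∁ I ] (𝟙 (2 ℕ.≤? ∣ T ∣) * inner T)
      ≡⟨ ∑⊆-cong (∁ I) (λ T _ → term T) ⟩
    ∑[ T ⊆ ∁ I ] (D * (b2q (sub? T N) * (sgn ∣ T ∣ * nat (∣ T ∣ ∸ 1))))
      ≡⟨ ∑⊆-*ˡ (∁ I) D (λ T → b2q (sub? T N) * (sgn ∣ T ∣ * nat (∣ T ∣ ∸ 1))) ⟩
    D * ∑[ T ⊆ ∁ I ] (b2q (sub? T N) * (sgn ∣ T ∣ * nat (∣ T ∣ ∸ 1)))
      ≡⟨ cong (D *_) (trans (∑⊆-∩ (∁ I) N (λ T → sgn ∣ T ∣ * nat (∣ T ∣ ∸ 1))) (∑⊆-sgn-pred (∁ I ∩ N))) ⟩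
    D * (1ℚ - (𝟙 (∣ ∁ I ∩ N ∣ ℕ.≟ 0) + 𝟙 (∣ ∁ I ∩ N ∣ ℕ.≟ 1)))
      ∎
    where
    open ≡-Reasoning
    D = 𝟙 (∣ I ∩ N ∣ ℕ.≟ 0)
    inner : Subset n → ℚ
    inner T = sumSub (λ B → sub? B I) (λ B → sgn (∣ T ∣ ℕ.+ ∣ B ∣) * (nat (∣ T ∣ ∸ 1) * xS v (T ∪ B)))
    term : ∀ T → 𝟙 (2 ℕ.≤? ∣ T ∣) * inner T ≡ D * (b2q (sub? T N) * (sgn ∣ T ∣ * nat (∣ T ∣ ∸ 1)))
    term T = begin
      g * inner T                  ≡⟨ 𝟙*-cong (2 ℕ.≤? ∣ T ∣) (oneCI-summand-vertex T) ⟩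
      g * ((s * (σ * m)) * D)      ≡⟨ solve 5 (λ g s σ m d → g :* ((s :* (σ :* m)) :* d) := d :* (s :* (g :* (σ :* m)))) refl g s σ m D ⟩
      D * (s * (g * (σ * m)))      ≡⟨ cong (λ z → D * (s * z)) (drop-guard ∣ T ∣) ⟩
      D * (s * (σ * m))            ∎
      where
      g = 𝟙 (2 ℕ.≤? ∣ T ∣)
      s = b2q (sub? T N)
      σ = sgn ∣ T ∣
      m = nat (∣ T ∣ ∸ 1)
      -- With truncated subtraction nat (k ∸ 1) already vanishes for k ≤ 1.
      drop-guard : ∀ k → 𝟙 (2 ℕ.≤? k) * (sgn k * nat (k ∸ 1)) ≡ sgn k * nat (k ∸ 1)
      drop-guard zero          = refl
      drop-guard (suc zero)    = refl
      drop-guard (suc (suc k)) = ℚP.*-identityˡ _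

  sum-xB-vertex : sumList (xB v) (members I) ≡ (nat ∣ I ∣) - (nat ∣ I ∩ N ∣)
  sum-xB-vertex = begin
    sumList (xB v) (members I)
      ≡⟨ sumList-cong (members I) (λ u∈ → xB-vertex I o (proj₂ (∈-filter⁻ (_∈? I) {xs = allFin n} u∈))) ⟩
    sumList (λ u → 1ℚ - 𝟙 (u ∈? N)) (members I)
      ≡⟨ sumList-+ (λ _ → 1ℚ) (λ u → - 𝟙 (u ∈? N)) (members I) ⟩
    sumList (λ _ → 1ℚ) (members I) + sumList (λ u → - 𝟙 (u ∈? N)) (members I)
      ≡⟨ cong (sumList (λ _ → 1ℚ) (members I) +_) (sumList-neg (λ u → 𝟙 (u ∈? N)) (members I)) ⟩
    sumList (λ _ → 1ℚ) (members I) - sumList (λ u → 𝟙 (u ∈? N)) (members I)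
      ≡⟨ cong₂ _-_ (count-members I) (count-members-∈ I N) ⟩
    (nat ∣ I ∣) - (nat ∣ I ∩ N ∣)
      ∎
    where open ≡-Reasoning

  slack-vertex : ∀ g → ValidIneq I g → slack I g v ≡ vertexSlack I g N
  slack-vertex (star T)  2≤∣T∣ = trans (ℚP.+-identityˡ (starLHS T v)) (starLHS-vertex T 2≤∣T∣)
  slack-vertex (bidir u) u∈I   = trans (cong (λ z → 1ℚ - z) (bidirLHS-vertex u∈I))
    (solve 1 (λ w → con 1ℚ :- (con 1ℚ :- w) := w) refl (vertexSlack I (bidir u) N))
  slack-vertex forked    _     = begin
    (1ℚ - nat ∣ I ∣) + ((hashI I v - oneCI I v) + sumList (xB v) (members I))
      ≡⟨ cong₂ (λ h c → (1ℚ - nat ∣ I ∣) + ((h - c) + sumList (xB v) (members I))) hashI-vertex oneCI-vertex ⟩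
    (1ℚ - nat ∣ I ∣) + ((((Z - 1ℚ) + nat ∣ I ∩ N ∣) - Z * (1ℚ - (Z′ + O′))) + sumList (xB v) (members I))
      ≡⟨ cong (λ s → (1ℚ - nat ∣ I ∣) + ((((Z - 1ℚ) + nat ∣ I ∩ N ∣) - Z * (1ℚ - (Z′ + O′))) + s)) sum-xB-vertex ⟩
    (1ℚ - nat ∣ I ∣) + ((((Z - 1ℚ) + nat ∣ I ∩ N ∣) - Z * (1ℚ - (Z′ + O′))) + ((nat ∣ I ∣) - (nat ∣ I ∩ N ∣)))
      ≡⟨ solve 5 (λ a c z z′ o′ → (con 1ℚ :- a) :+ ((((z :- con 1ℚ) :+ c) :- z :* (con 1ℚ :- (z′ :+ o′))) :+ (a :- c))
                                   := z :* (z′ :+ o′))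
               refl (nat ∣ I ∣) (nat ∣ I ∩ N ∣) Z Z′ O′ ⟩
    Z * (Z′ + O′)
      ∎
    where
    open ≡-Reasoning
    Z  = 𝟙 (∣ I ∩ N ∣ ℕ.≟ 0)
    Z′ = 𝟙 (∣ ∁ I ∩ N ∣ ℕ.≟ 0)
    O′ = 𝟙 (∣ ∁ I ∩ N ∣ ℕ.≟ 1)

facetParents : ∀ {n} → Ineq n → Subset n
facetParents (star T)  = T
facetParents (bidir u) = ⁅ u ⁆
facetParents forked    = ⊥

vertexSlack-diagonal : ∀ {n} (I : Subset n) g → vertexSlack I g (facetParents g) ≡ 1ℚ
vertexSlack-diagonal I (star T)  = 𝟙-yes (T ≟ₛ T) refl
vertexSlack-diagonal {n} I (bidir u) =
  cong₂ _*_ (𝟙-yes (u ∈? ⁅ u ⁆) (x∈⁅x⁆ u)) (𝟙-yes (∣ ∁ ⁅ u ⁆ ∩ ⁅ u ⁆ ∣ ℕ.≟ 0) (trans (cong ∣_∣ (∩-inverseˡ ⁅ u ⁆)) (∣⊥∣≡0 n)))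
vertexSlack-diagonal {n} I forked rewrite ∩-zeroʳ I | ∩-zeroʳ (∁ I) | ∣⊥∣≡0 n = refl

vertexSlack-offDiagonal : ∀ {n} (I : Subset n) g f → ValidIneq I g → ValidIneq I f → g ≢ f →
                          vertexSlack I g (facetParents f) ≡ 0ℚ
vertexSlack-offDiagonal I (star T) (star T′) _ _ g≢f = 𝟙-no (T ≟ₛ T′) (g≢f ∘ cong star)
vertexSlack-offDiagonal I (star T) (bidir w) 2≤∣T∣ _ _ = 𝟙-no (T ≟ₛ ⁅ w ⁆)
  (λ T≡⁅w⁆ → 2≰1 (subst (2 ≤_) (trans (cong ∣_∣ T≡⁅w⁆) (∣⁅x⁆∣≡1 w)) 2≤∣T∣))
vertexSlack-offDiagonal {n} I (star T) forked 2≤∣T∣ _ _ = 𝟙-no (T ≟ₛ ⊥)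
  (λ T≡⊥ → 2≰0 (subst (2 ≤_) (trans (cong ∣_∣ T≡⊥) (∣⊥∣≡0 n)) 2≤∣T∣))
vertexSlack-offDiagonal I (bidir u) (star T′) _ 2≤∣T′∣ _ =
  trans (cong (𝟙 (u ∈? T′) *_) (𝟙-no (∣ ∁ ⁅ u ⁆ ∩ T′ ∣ ℕ.≟ 0) ∣∁⁅u⁆∩T′∣≢0)) (ℚP.*-zeroʳ (𝟙 (u ∈? T′)))
  where
  ∣∁⁅u⁆∩T′∣≢0 : ∣ ∁ ⁅ u ⁆ ∩ T′ ∣ ≢ 0
  ∣∁⁅u⁆∩T′∣≢0 ∣∁⁅u⁆∩T′∣≡0 = ℕP.<⇒≱ 2≤∣T′∣ (begin
    ∣ T′ ∣                                     ≡⟨ ∣p∩q∣+∣∁p∩q∣ ⁅ u ⁆ T′ ⟨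
    ∣ ⁅ u ⁆ ∩ T′ ∣ ℕ.+ ∣ ∁ ⁅ u ⁆ ∩ T′ ∣         ≡⟨ cong (∣ ⁅ u ⁆ ∩ T′ ∣ ℕ.+_) ∣∁⁅u⁆∩T′∣≡0 ⟩
    ∣ ⁅ u ⁆ ∩ T′ ∣ ℕ.+ 0                        ≡⟨ ℕP.+-identityʳ _ ⟩
    ∣ ⁅ u ⁆ ∩ T′ ∣                              ≤⟨ ∣p∩q∣≤∣p∣ ⁅ u ⁆ T′ ⟩
    ∣ ⁅ u ⁆ ∣                                   ≡⟨ ∣⁅x⁆∣≡1 u ⟩
    1                                          ∎)
    where open ℕP.≤-Reasoning
vertexSlack-offDiagonal I (bidir u) (bidir w) _ _ g≢f =
  trans (cong (_* 𝟙 (∣ ∁ ⁅ u ⁆ ∩ ⁅ w ⁆ ∣ ℕ.≟ 0)) (𝟙-no (u ∈? ⁅ w ⁆) (x≢y⇒x∉⁅y⁆ (g≢f ∘ cong bidir))))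
        (ℚP.*-zeroˡ (𝟙 (∣ ∁ ⁅ u ⁆ ∩ ⁅ w ⁆ ∣ ℕ.≟ 0)))
vertexSlack-offDiagonal I (bidir u) forked _ _ _ =
  trans (cong (_* 𝟙 (∣ ∁ ⁅ u ⁆ ∩ ⊥ ∣ ℕ.≟ 0)) (𝟙-no (u ∈? ⊥) ∉⊥)) (ℚP.*-zeroˡ (𝟙 (∣ ∁ ⁅ u ⁆ ∩ ⊥ ∣ ℕ.≟ 0)))
vertexSlack-offDiagonal I forked (star T′) _ 2≤∣T′∣ _ = 𝟙*≡0 (∣ I ∩ T′ ∣ ℕ.≟ 0) λ ∣I∩T′∣≡0 →
  let ∣∁I∩T′∣≡∣T′∣ = trans (cong (ℕ._+ ∣ ∁ I ∩ T′ ∣) (sym ∣I∩T′∣≡0)) (∣p∩q∣+∣∁p∩q∣ I T′) in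
  trans (cong₂ _+_ (𝟙-no (∣ ∁ I ∩ T′ ∣ ℕ.≟ 0) (λ eq → 2≰0 (subst (2 ≤_) (trans (sym ∣∁I∩T′∣≡∣T′∣) eq) 2≤∣T′∣)))
                   (𝟙-no (∣ ∁ I ∩ T′ ∣ ℕ.≟ 1) (λ eq → 2≰1 (subst (2 ≤_) (trans (sym ∣∁I∩T′∣≡∣T′∣) eq) 2≤∣T′∣))))
        (ℚP.+-identityʳ 0ℚ)
vertexSlack-offDiagonal I forked (bidir w) _ w∈I _ =
  trans (cong (_* Σ) (𝟙-no (∣ I ∩ ⁅ w ⁆ ∣ ℕ.≟ 0) (x∈p⇒∣p∣≢0 (x∈p∩q⁺ (w∈I , x∈⁅x⁆ w))))) (ℚP.*-zeroˡ Σ)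
  where Σ = 𝟙 (∣ ∁ I ∩ ⁅ w ⁆ ∣ ℕ.≟ 0) + 𝟙 (∣ ∁ I ∩ ⁅ w ⁆ ∣ ℕ.≟ 1)
vertexSlack-offDiagonal I forked forked _ _ g≢f = ⊥-elim (g≢f refl)

InCIM⇒SatisfiesAll : ∀ {n} (I : Subset n) x → InCIM I x → SatisfiesAll I x
InCIM⇒SatisfiesAll I x (k , w , os , 0≤w , Σw≡1 , x≡) g valid =
  Equivalence.from (holds⇔slack-nonneg I g x)
    (subst (0ℚ ℚ.≤_) (sym slack≡) (sumFin-nonneg _ (λ i → nonneg-* (0≤w i) (vertexSlack-nonneg I g (parents (os i))))))
  where
  open ≡-Reasoning
  p : Fin k → Point _ I
  p i = cimVertex I (os i)
  slack≡ : slack I g x ≡ sumFin (λ i → w i * vertexSlack I g (parents (os i)))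
  slack≡ = begin
    slackConst I g + slackLinear I g x               ≡⟨ cong (slackConst I g +_) (resp-≗ (slackLinear-linear I g) x≡) ⟩
    slackConst I g + slackLinear I g (lincomb w p)   ≡⟨ affine-lincomb (slackLinear-linear I g) (slackConst I g) w p Σw≡1 ⟩
    sumFin (λ i → w i * slack I g (p i))             ≡⟨ sumFin-cong (λ i → cong (w i *_) (slack-vertex I (os i) g valid)) ⟩
    sumFin (λ i → w i * vertexSlack I g (parents (os i))) ∎

allSubsets-complete : ∀ {n} (T : Subset n) → T ∈ˡ allSubsets n
allSubsets-complete []                  = here refl
allSubsets-complete {suc n} (true ∷ T)  = ∈-++⁺ˡ (∈-map⁺ (true ∷_) (allSubsets-complete T))
allSubsets-complete {suc n} (false ∷ T) = ∈-++⁺ʳ (map (true ∷_) (allSubsets n)) (∈-map⁺ (false ∷_) (allSubsets-complete T))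

allSubsets-unique : ∀ n → Unique (allSubsets n)
allSubsets-unique zero    = All.[] ∷ []
allSubsets-unique (suc n) =
  Unique.++⁺ (Unique.map⁺ ∷-injectiveʳ (allSubsets-unique n)) (Unique.map⁺ ∷-injectiveʳ (allSubsets-unique n)) disjoint
  where
  disjoint : ∀ {U} → ¬ (U ∈ˡ map (true ∷_) (allSubsets n) × U ∈ˡ map (false ∷_) (allSubsets n))
  disjoint (U∈ , U∈′) with ∈-map⁻ (true ∷_) U∈ | ∈-map⁻ (false ∷_) U∈′
  ... | _ , _ , refl | _ , _ , ()

allIneqs : ∀ n → List (Ineq n)
allIneqs n = map star (allSubsets n) ++ map bidir (allFin n) ++ forked ∷ []

allIneqs-complete : ∀ {n} (g : Ineq n) → g ∈ˡ allIneqs n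
allIneqs-complete (star T)  = ∈-++⁺ˡ (∈-map⁺ star (allSubsets-complete T))
allIneqs-complete {n} (bidir u) = ∈-++⁺ʳ (map star (allSubsets n)) (∈-++⁺ˡ (∈-map⁺ bidir (∈-allFin u)))
allIneqs-complete {n} forked    = ∈-++⁺ʳ (map star (allSubsets n)) (∈-++⁺ʳ (map bidir (allFin n)) (here refl))

allIneqs-unique : ∀ n → Unique (allIneqs n)
allIneqs-unique n = Unique.++⁺ (Unique.map⁺ (λ { refl → refl }) (allSubsets-unique n))
  (Unique.++⁺ (Unique.map⁺ (λ { refl → refl }) (Unique.allFin⁺ n)) (All.[] ∷ []) bidir∉forked) star∉rest
  where
  bidir∉forked : ∀ {g} → ¬ (g ∈ˡ map bidir (allFin n) × g ∈ˡ forked ∷ [])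
  bidir∉forked (g∈ , here refl) with ∈-map⁻ bidir g∈
  ... | _ , _ , ()
  star∉rest : ∀ {g} → ¬ (g ∈ˡ map star (allSubsets n) × g ∈ˡ map bidir (allFin n) ++ forked ∷ [])
  star∉rest (g∈ , g∈′) with ∈-map⁻ star g∈
  ... | _ , _ , refl with ∈-++⁻ (map bidir (allFin n)) g∈′
  ...   | inj₁ g∈″ with ∈-map⁻ bidir g∈″
  ...     | _ , _ , ()
  star∉rest (g∈ , g∈′) | _ , _ , refl | inj₂ (here ())

valid? : ∀ {n} (I : Subset n) → Decidable (ValidIneq I)
valid? I (star T)  = 2 ℕ.≤? ∣ T ∣
valid? I (bidir u) = u ∈? I
valid? I forked    = yes tt

lookup-injective : ∀ {a} {A : Set a} {xs : List A} → Unique xs → ∀ i j → lookup xs i ≡ lookup xs j → i ≡ j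
lookup-injective (_ ∷ _)    zero    zero    _  = refl
lookup-injective (x∉ ∷ _)   zero    (suc j) eq = ⊥-elim (All.lookup x∉ (∈-lookup j) eq)
lookup-injective (x∉ ∷ _)   (suc i) zero    eq = ⊥-elim (All.lookup x∉ (∈-lookup i) (sym eq))
lookup-injective (_ ∷ uniq) (suc i) (suc j) eq = cong suc (lookup-injective uniq i j eq)

module Facets {n} (I : Subset n) where

  facets : List (Ineq n)
  facets = filter (valid? I) (allIneqs n)

  m : ℕ
  m = length facets

  facet : Fin m → Ineq n
  facet = lookup facets

  facet-valid : ∀ j → ValidIneq I (facet j)
  facet-valid j = proj₂ (∈-filter⁻ (valid? I) {xs = allIneqs n} (∈-lookup j))

  facet-surjective : ∀ {g} → ValidIneq I g → ∃[ j ] facet j ≡ g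
  facet-surjective {g} valid = Any.index g∈ , sym (Anyₚ.lookup-index g∈)
    where g∈ = ∈-filter⁺ (valid? I) (allIneqs-complete g) valid

  facet-injective : ∀ {j k} → facet j ≡ facet k → j ≡ k
  facet-injective = lookup-injective (Unique.filter⁺ (valid? I) (allIneqs-unique n)) _ _

  orientation : Fin m → Orientation n
  orientation k = withParents (facetParents (facet k))

  vertex : Fin m → Point n I
  vertex k = cimVertex I (orientation k)

  dual : ∀ j k → slack I (facet j) (vertex k) ≡ 𝟙 (j Fin.≟ k)
  dual j k = begin
    slack I (facet j) (vertex k)                                 ≡⟨ slack-vertex I (orientation k) (facet j) (facet-valid j) ⟩
    vertexSlack I (facet j) (parents (orientation k))            ≡⟨ cong (vertexSlack I (facet j)) (parents-withParents _) ⟩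
    vertexSlack I (facet j) (facetParents (facet k))             ≡⟨ δ (j Fin.≟ k) ⟩
    𝟙 (j Fin.≟ k)                                                ∎
    where
    open ≡-Reasoning
    δ : (j≟k : Dec (j ≡ k)) → vertexSlack I (facet j) (facetParents (facet k)) ≡ b2q (does j≟k)
    δ (yes refl) = vertexSlack-diagonal I (facet j)
    δ (no j≢k)   = vertexSlack-offDiagonal I (facet j) (facet k) (facet-valid j) (facet-valid k) (j≢k ∘ facet-injective)

  injective : ∀ d t → (∀ j → slackLinear I (facet j) d ≡ slackConst I (facet j) * t) → t ≡ 0ℚ × (∀ κ → d κ ≡ 0ℚ)
  injective d t L≡ct = slackLinear-injective I d t λ g valid →
    let j , facet[j]≡g = facet-surjective valid
    in subst (λ g → slackLinear I g d ≡ slackConst I g * t) facet[j]≡g (L≡ct j)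

  open DualBasis (slackConst I ∘ facet) (slackLinear I ∘ facet) (slackLinear-linear I ∘ facet) vertex dual injective public

  SatisfiesAll⇒InConv : ∀ x → SatisfiesAll I x → InConv vertex x
  SatisfiesAll⇒InConv x sat = Equivalence.to (nonneg⇔InConv x) λ j →
    Equivalence.to (holds⇔slack-nonneg I (facet j) x) (sat (facet j) (facet-valid j))

  InConv⇒InCIM : ∀ x → InConv vertex x → InCIM I x
  InConv⇒InCIM x (w , conv) = m , w , orientation , conv

  another-facet : 2 ≤ n → ∀ i → ∃[ g ] (ValidIneq I g × g ≢ i)
  another-facet _   (star T)  = forked , tt , λ ()
  another-facet _   (bidir u) = forked , tt , λ ()
  another-facet 2≤n forked    = star ⊤ , subst (2 ≤_) (sym (∣⊤∣≡n n)) 2≤n , λ ()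

  isIrredundant : 2 ≤ n → IsIrredundant I
  isIrredundant 2≤n i valid-i = x , holds-others , violates
    where
    a : Fin m
    a = proj₁ (facet-surjective valid-i)
    facet[a]≡i : facet a ≡ i
    facet[a]≡i = proj₂ (facet-surjective valid-i)
    other = another-facet 2≤n i
    b : Fin m
    b = proj₁ (facet-surjective (proj₁ (proj₂ other)))
    b≢a : b ≢ a
    b≢a b≡a = proj₂ (proj₂ other) (trans (sym (proj₂ (facet-surjective (proj₁ (proj₂ other)))))
                                         (trans (cong facet b≡a) facet[a]≡i))
    witness = irredundant b≢a
    x : Point n I
    x = proj₁ witness
    holds-others : ∀ j → ValidIneq I j → j ≢ i → HoldsIneq I j x
    holds-others j valid-j j≢i = subst (λ j → HoldsIneq I j x) facet[c]≡j
      (Equivalence.from (holds⇔slack-nonneg I (facet c) x)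
        (proj₁ (proj₂ witness) c (λ c≡a → j≢i (trans (sym facet[c]≡j) (trans (cong facet c≡a) facet[a]≡i)))))
      where
      c : Fin m
      c = proj₁ (facet-surjective valid-j)
      facet[c]≡j : facet c ≡ j
      facet[c]≡j = proj₂ (facet-surjective valid-j)
    violates : ¬ HoldsIneq I i x
    violates holds = proj₂ (proj₂ witness)
      (Equivalence.to (holds⇔slack-nonneg I (facet a) x) (subst (λ i → HoldsIneq I i x) (sym facet[a]≡i) holds))

theorem5p18 : (n : ℕ) → 2 ≤ n → (I : Subset n) →
    IsHRep I × IsIrredundant I × IsSimplex I (InCIM I)
theorem5p18 n 2≤n I = hRep , isIrredundant 2≤n , simplex
  where
  open Facets I
  hRep : IsHRep I
  hRep x = mk⇔ (InCIM⇒SatisfiesAll I x) (InConv⇒InCIM x ∘ SatisfiesAll⇒InConv x)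
  simplex : IsSimplex I (InCIM I)
  simplex = m , vertex , affinelyIndependent , λ x →
    mk⇔ (SatisfiesAll⇒InConv x ∘ InCIM⇒SatisfiesAll I x) (InConv⇒InCIM x)
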